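{- Let $q$ be a power of a prime $p$, let $K$ be a global function field with full constant field $\mathbb{F}_q$, and let $n\ge2$ be an integer. For $r\ge1$ let $$D(r,K)=\sum_{d\mid r}\mu(d)\Big(\sum_{k\mid (n^{r/d}-1)^*}\frac{\varphi(k)}{l_k}+1\Big),$$ where $N^*$ is the largest divisor of $N$ relatively prime to $q$ and $l_k$ is the least positive integer $l$ with $q^l\equiv1\pmod k$, and let $C(r,K)=D(r,K)/r$. Then $\sum_{r\ge1}C(r,K)=\infty$; that is, the Dirichlet mean value of the number of cycles is infinite.
   Context: $\mu$ is the Möbius function and $\varphi$ is Euler's function. $D(r,K)$ is the Dirichlet mean value of the number of $r$-periodic points of $f(x)=x^n$ on the residue fields of the primes of $K$ (with respect to Dirichlet density on primes of $K$), and $C(r,K)$ is the Dirichlet mean value of the number of $r$-cycles. -}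

module Defs where

open import Data.Bool using (Bool; true; false; if_then_else_; _∧_; not)
open import Data.Nat using (ℕ; zero; suc; _+_; _*_; _∸_; _^_; _≤_; _≡ᵇ_)
open import Data.Nat.DivMod using (_/_; _%_)
open import Data.Nat.Divisibility using (_∣?_)
open import Data.Nat.GCD using (gcd)
open import Data.Nat.Primality using (prime?)
open import Data.List using (List; []; _∷_; filter; map; foldr; length; upTo; last)
open import Data.Maybe using (Maybe; just; nothing)
open import Data.Integer as ℤ using (ℤ; +_)
open import Data.Rational as ℚ using (ℚ; 0ℚ; 1ℚ)
open import Relation.Nullary using (does)
open import Relation.Nullary.Decidable using (⌊_⌋)
open import Relation.Unary using (Decidable)

oneTo : ℕ → List ℕ
oneTo n = map suc (upTo n)

divisors : ℕ → List ℕ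
divisors n = filter (λ d → d ∣? n) (oneTo n)

sumℚ : List ℚ → ℚ
sumℚ = foldr ℚ._+_ 0ℚ

sumℤ : List ℤ → ℤ
sumℤ = foldr ℤ._+_ (+ 0)

squarefree : ℕ → Bool
squarefree n = foldr _∧_ true
  (map (λ d → not (⌊ (suc d * suc d) ∣? n ⌋)) (oneTo n))

numPrimeDivisors : ℕ → ℕ
numPrimeDivisors n = length (filter (λ d → prime? d) (divisors n))

μ : ℕ → ℤ
μ n = if squarefree n
      then ℤ._^_ (ℤ.- (+ 1)) (numPrimeDivisors n)
      else + 0

φ : ℕ → ℕ
φ k = length (filter (λ i → gcd i k Data.Nat.≟ 1) (oneTo k))

coprimePart : (q N : ℕ) → ℕ
coprimePart q N with last (filter (λ d → gcd d q Data.Nat.≟ 1) (divisors N))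
... | just d  = d
... | nothing = 0

-- least l ≥ 1 (searched among 1..bound) with q^l ≡ 1 (mod k); returns
-- (l - 1), so that l = suc (ordPred q k).  For k ≥ 1 coprime to q the order
-- exists and is ≤ k, so the fallback value is never used in the theorem.
ordSearch : (q k : ℕ) → ℕ → ℕ → ℕ
ordSearch q k zero      l = l
ordSearch q k (suc fuel) l =
  if ((q ^ suc l) % suc (k ∸ 1)) ≡ᵇ (1 % suc (k ∸ 1))
  then l else ordSearch q k fuel (suc l)

ordPred : (q k : ℕ) → ℕ
ordPred q k = ordSearch q k k 0

ord : (q k : ℕ) → ℕ
ord q k = suc (ordPred q k)

-- D(r,K) = Σ_{d ∣ r} μ(d) ( Σ_{k ∣ (n^{r/d} - 1)^*} φ(k)/l_k + 1 )
-- (depends on K only through q = #constant field)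
D : (q n r : ℕ) → ℚ
D q n r = sumℚ (map term (divisors r))
  where
  inner : ℕ → ℚ
  inner d = sumℚ (map (λ k → (+ φ k) ℚ./ suc (ordPred q k))
                      (divisors (coprimePart q (n ^ (r / suc (d ∸ 1)) ∸ 1))))
            ℚ.+ 1ℚ
  term : ℕ → ℚ
  term d = (μ d ℚ./ 1) ℚ.* inner d

C : (q n r : ℕ) → ℚ
C q n r = D q n r ℚ.* (+ 1 ℚ./ suc (r ∸ 1))

partialC : (q n M : ℕ) → ℚ
partialC q n M = sumℚ (map (C q n) (oneTo M))

module Submission where

-- Write F(m) = Σ_{k ∣ (n^m - 1)^*} φ(k)/l_k + 1, so that
-- D(r) = Σ_{d ∣ r} μ(d) F(r/d).  Expanding F and exchanging the two sums gives
--     D(r) = Σ_{k ≤ n^r} a_q(k) W_k(r) + Σ_{d ∣ r} μ(d),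
-- where a_q(k) = φ(k)/l_k for k prime to q (0 otherwise) and
-- W_k(r) = Σ_{d ∣ r} μ(d) [n^(r/d) ≡ 1 mod k].  Since Σ_{d ∣ s} μ(d) = [s = 1]
-- and W_k(r) = Σ_{d ∣ r/o} μ(d) when o = ord_k(n) divides r (0 otherwise),
-- all summands are non-negative: D(r) ≥ 0, and D(r) ≥ φ(k)/l_k whenever n has
-- order exactly r modulo k.  For the repunit k = S_r = 1 + n + ⋯ + n^(r-1)
-- (r ≥ 2) the order is r, and l_k ≤ φ(k), so C(r) ≥ 1/r as soon as p ∤ S_r.
-- The residues of S_r mod p are periodic, which yields P ≥ 1 with
-- p ∤ S_(1+jP) for all j; the partial sums of C therefore dominate
-- Σ_j 1/(1 + jP), a harmonic-type series that diverges.

open import Defs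
open import Data.Nat using (ℕ; _≤_; _^_)
open import Data.Nat.Primality using (Prime)
open import Data.Product using (∃-syntax; _×_)
open import Data.Rational using (ℚ) renaming (_≤_ to _≤ℚ_)
open import Relation.Binary.PropositionalEquality using (_≡_)

open import Algebra.Bundles using (CommutativeMonoid)
import Algebra.Properties.CommutativeSemigroup as CommutativeSemigroupProperties
import Algebra.Properties.Group as GroupProperties
open import Data.Bool using (Bool; true; false; if_then_else_; _∧_; not; T)
open import Data.Bool.Properties using (∧-zeroʳ)
open import Data.Empty using (⊥; ⊥-elim)
open import Data.Fin using (Fin; toℕ; fromℕ<)
import Data.Fin.Properties as FinP
open import Data.Integer as ℤ using (+_)
import Data.Integer.Properties as ℤP
open import Data.List using (List; []; _∷_; filter; map; applyUpTo; upTo; length; foldr; last; _++_; _∷ʳ_)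
open import Data.List.Properties using (map-∘; map-upTo; length-++; filter-++; applyUpTo-∷ʳ)
open import Data.List.Relation.Unary.All using (_∷_)
open import Data.Maybe using (Maybe; just; nothing)
open import Data.Nat as ℕ using (zero; suc; _+_; _*_; _∸_; _<_; z≤n; s≤s; _/_; _%_; _≡ᵇ_; NonZero)
open import Data.Nat.Coprimality using (Coprime; coprime-divisor; gcd≡1⇒coprime; coprime⇒gcd≡1)
open import Data.Nat.DivMod
open import Data.Nat.Divisibility
open import Data.Nat.GCD
open import Data.Nat.LCM
open import Data.Nat.ListAction using (product)
open import Data.Nat.Primality
open import Data.Nat.Primality.Factorisation
import Data.Nat.Properties as ℕP
open import Data.Nat.Tactic.RingSolver using (solve-∀)
open import Data.Product using (_,_; ∃; proj₁; proj₂)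
open import Data.Rational as ℚ using (0ℚ; 1ℚ; mkℚ)
import Data.Rational.Properties as ℚP
open import Data.Rational.Unnormalised using (mkℚᵘ; *≤*; *≡*)
import Data.Rational.Unnormalised.Properties as ℚᵘP
open import Data.Sum using (_⊎_; inj₁; inj₂; [_,_])
open import Function using (_∘_; case_of_)
open import Function.Bundles using (mk⇔)
open import Relation.Binary.Definitions using (tri<; tri≈; tri>)
open import Relation.Binary.PropositionalEquality
  using (refl; sym; trans; cong; cong₂; subst; subst₂; _≢_; module ≡-Reasoning)
open import Relation.Nullary using (Dec; yes; no; ¬_; does)
open import Relation.Nullary.Decidable using (⌊_⌋; _×-dec_; dec-true; dec-false; does-⇔; isYes≗does)
open import Relation.Unary using (Decidable)

open CommutativeSemigroupProperties
  (CommutativeMonoid.commutativeSemigroup ℚP.+-0-commutativeMonoid) using (interchange)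
open GroupProperties ℚP.+-0-group using (⁻¹-involutive)

if-true : ∀ {A : Set} {b} {x y : A} → b ≡ true → (if b then x else y) ≡ x
if-true refl = refl

if-false : ∀ {A : Set} {b} {x y : A} → b ≡ false → (if b then x else y) ≡ y
if-false refl = refl

-- Σ f n = f 1 + ⋯ + f n.  Every sum in D, C and partialC ranges over (a
-- filtered part of) 1, …, n, so this is the only summation operator needed.
Σ : (ℕ → ℚ) → ℕ → ℚ
Σ f zero    = 0ℚ
Σ f (suc n) = Σ f n ℚ.+ f (suc n)

map-oneTo : ∀ {A : Set} (g : ℕ → A) n → map g (oneTo n) ≡ applyUpTo (g ∘ suc) n
map-oneTo g n = trans (sym (map-∘ (upTo n))) (map-upTo (g ∘ suc) n)

sumℚ-oneTo : ∀ (f : ℕ → ℚ) n → sumℚ (map f (oneTo n)) ≡ Σ f n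
sumℚ-oneTo f n = trans (cong sumℚ (map-oneTo f n)) (go n)
  where
  snoc : ∀ (g : ℕ → ℚ) n → sumℚ (applyUpTo g (suc n)) ≡ sumℚ (applyUpTo g n) ℚ.+ g n
  snoc g zero    = trans (ℚP.+-identityʳ (g 0)) (sym (ℚP.+-identityˡ (g 0)))
  snoc g (suc n) = trans (cong (g 0 ℚ.+_) (snoc (g ∘ suc) n)) (sym (ℚP.+-assoc (g 0) _ _))
  go : ∀ n → sumℚ (applyUpTo (f ∘ suc) n) ≡ Σ f n
  go zero    = refl
  go (suc n) = trans (snoc (f ∘ suc) n) (cong (ℚ._+ f (suc n)) (go n))

sumℚ-filter : ∀ {P : ℕ → Set} (P? : Decidable P) (g : ℕ → ℚ) xs →
  sumℚ (map g (filter P? xs)) ≡ sumℚ (map (λ x → if does (P? x) then g x else 0ℚ) xs)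
sumℚ-filter P? g [] = refl
sumℚ-filter P? g (x ∷ xs) with does (P? x)
... | true  = cong (g x ℚ.+_) (sumℚ-filter P? g xs)
... | false = trans (sumℚ-filter P? g xs) (sym (ℚP.+-identityˡ _))

Σ-cong-on : ∀ {f g : ℕ → ℚ} n → (∀ i → 1 ≤ i → i ≤ n → f i ≡ g i) → Σ f n ≡ Σ g n
Σ-cong-on zero    h = refl
Σ-cong-on (suc n) h =
  cong₂ ℚ._+_ (Σ-cong-on n (λ i a b → h i a (ℕP.m≤n⇒m≤1+n b))) (h (suc n) (s≤s z≤n) ℕP.≤-refl)

Σ-cong : ∀ {f g : ℕ → ℚ} n → (∀ i → f i ≡ g i) → Σ f n ≡ Σ g n
Σ-cong n h = Σ-cong-on n (λ i _ _ → h i)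

Σ-zero : ∀ n → Σ (λ _ → 0ℚ) n ≡ 0ℚ
Σ-zero zero    = refl
Σ-zero (suc n) = trans (ℚP.+-identityʳ _) (Σ-zero n)

Σ-+ : ∀ (f g : ℕ → ℚ) n → Σ (λ i → f i ℚ.+ g i) n ≡ Σ f n ℚ.+ Σ g n
Σ-+ f g zero    = refl
Σ-+ f g (suc n) = trans (cong (ℚ._+ (f (suc n) ℚ.+ g (suc n))) (Σ-+ f g n))
  (interchange (Σ f n) (Σ g n) (f (suc n)) (g (suc n)))

Σ-neg : ∀ (f : ℕ → ℚ) n → Σ (λ i → ℚ.- f i) n ≡ ℚ.- Σ f n
Σ-neg f zero    = refl
Σ-neg f (suc n) =
  trans (cong (ℚ._+ ℚ.- f (suc n)) (Σ-neg f n)) (sym (ℚP.neg-distrib-+ (Σ f n) (f (suc n))))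

Σ-*ˡ : ∀ c (f : ℕ → ℚ) n → c ℚ.* Σ f n ≡ Σ (λ i → c ℚ.* f i) n
Σ-*ˡ c f zero    = ℚP.*-zeroʳ c
Σ-*ˡ c f (suc n) =
  trans (ℚP.*-distribˡ-+ c (Σ f n) (f (suc n))) (cong (ℚ._+ (c ℚ.* f (suc n))) (Σ-*ˡ c f n))

Σ-swap : ∀ (F : ℕ → ℕ → ℚ) n m → Σ (λ i → Σ (F i) m) n ≡ Σ (λ j → Σ (λ i → F i j) n) m
Σ-swap F zero    m = sym (Σ-zero m)
Σ-swap F (suc n) m = trans (cong (ℚ._+ Σ (F (suc n)) m) (Σ-swap F n m))
  (sym (Σ-+ (λ j → Σ (λ i → F i j) n) (F (suc n)) m))

Σ-split : ∀ (f : ℕ → ℚ) a b → Σ f (b + a) ≡ Σ f a ℚ.+ Σ (λ i → f (i + a)) b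
Σ-split f a zero    = sym (ℚP.+-identityʳ _)
Σ-split f a (suc b) = trans (cong (ℚ._+ f (suc b + a)) (Σ-split f a b)) (ℚP.+-assoc (Σ f a) _ _)

Σ-vanishing-tail : ∀ (f : ℕ → ℚ) n m → n ≤ m → (∀ i → n < i → f i ≡ 0ℚ) → Σ f m ≡ Σ f n
Σ-vanishing-tail f n m n≤m vanish =
  trans (cong (Σ f) (sym (ℕP.m∸n+n≡m n≤m))) (go (m ∸ n))
  where
  go : ∀ k → Σ f (k + n) ≡ Σ f n
  go zero    = refl
  go (suc k) = trans (cong (Σ f (k + n) ℚ.+_) (vanish (suc (k + n)) (s≤s (ℕP.m≤n+m n k))))
    (trans (ℚP.+-identityʳ _) (go k))

Σ-last : ∀ (f : ℕ → ℚ) p → (∀ i → 1 ≤ i → i < suc p → f i ≡ 0ℚ) → Σ f (suc p) ≡ f (suc p)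
Σ-last f p vanish = trans (cong (ℚ._+ f (suc p))
  (trans (Σ-cong-on p (λ i a b → vanish i a (s≤s b))) (Σ-zero p))) (ℚP.+-identityˡ _)

Σ-nonneg : ∀ (f : ℕ → ℚ) n → (∀ i → 1 ≤ i → i ≤ n → 0ℚ ℚ.≤ f i) → 0ℚ ℚ.≤ Σ f n
Σ-nonneg f zero    h = ℚP.≤-refl
Σ-nonneg f (suc n) h = ℚP.+-mono-≤ (Σ-nonneg f n (λ i a b → h i a (ℕP.m≤n⇒m≤1+n b)))
  (h (suc n) (s≤s z≤n) ℕP.≤-refl)

Σ-mono : ∀ (f g : ℕ → ℚ) n → (∀ i → 1 ≤ i → i ≤ n → f i ℚ.≤ g i) → Σ f n ℚ.≤ Σ g n
Σ-mono f g zero    h = ℚP.≤-refl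
Σ-mono f g (suc n) h = ℚP.+-mono-≤ (Σ-mono f g n (λ i a b → h i a (ℕP.m≤n⇒m≤1+n b)))
  (h (suc n) (s≤s z≤n) ℕP.≤-refl)

term≤Σ : ∀ (f : ℕ → ℚ) n j → (∀ i → 1 ≤ i → i ≤ n → 0ℚ ℚ.≤ f i) →
  1 ≤ j → j ≤ n → f j ℚ.≤ Σ f n
term≤Σ f zero    j h () z≤n
term≤Σ f (suc n) j h 1≤j j≤n with j ℕP.≟ suc n
... | yes refl = subst (ℚ._≤ Σ f (suc n)) (ℚP.+-identityˡ (f (suc n)))
  (ℚP.+-monoˡ-≤ (f (suc n)) (Σ-nonneg f n (λ i a b → h i a (ℕP.m≤n⇒m≤1+n b))))
... | no j≢ = subst (ℚ._≤ Σ f (suc n)) (ℚP.+-identityʳ (f j))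
  (ℚP.+-mono-≤ (term≤Σ f n j (λ i a b → h i a (ℕP.m≤n⇒m≤1+n b)) 1≤j (ℕ.s≤s⁻¹ (ℕP.≤∧≢⇒< j≤n j≢)))
               (h (suc n) (s≤s z≤n) ℕP.≤-refl))

Σ-mono-length : ∀ (f : ℕ → ℚ) n m → n ≤ m → (∀ i → 1 ≤ i → 0ℚ ℚ.≤ f i) → Σ f n ℚ.≤ Σ f m
Σ-mono-length f n m n≤m h = subst (λ z → Σ f n ℚ.≤ Σ f z) (ℕP.m∸n+n≡m n≤m)
  (subst (ℚ._≤ Σ f ((m ∸ n) + n)) (ℚP.+-identityʳ (Σ f n))
  (ℚP.≤-trans (ℚP.+-monoʳ-≤ (Σ f n) (Σ-nonneg _ (m ∸ n) (λ i a _ → h (i + n) (ℕP.≤-trans a (ℕP.m≤m+n i n)))))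
     (ℚP.≤-reflexive (sym (Σ-split f n (m ∸ n))))))

count : (ℕ → Bool) → ℕ → ℕ
count b zero    = 0
count b (suc n) = count b n + (if b (suc n) then 1 else 0)

length-filter-oneTo : ∀ {P : ℕ → Set} (P? : Decidable P) n →
  length (filter P? (oneTo n)) ≡ count (λ i → does (P? i)) n
length-filter-oneTo P? n =
  trans (cong (length ∘ filter P?) (map-upTo suc n)) (go n)
  where
  snoc : ∀ (g : ℕ → ℕ) n → length (filter P? (applyUpTo g (suc n))) ≡
    length (filter P? (applyUpTo g n)) + (if does (P? (g n)) then 1 else 0)
  snoc g n = trans (cong (length ∘ filter P?) (sym (applyUpTo-∷ʳ g n)))
    (trans (cong length (filter-++ P? (applyUpTo g n) (g n ∷ [])))
      (trans (length-++ (filter P? (applyUpTo g n))) (cong₂ _+_ refl (one (g n)))))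
    where
    one : ∀ x → length (filter P? (x ∷ [])) ≡ (if does (P? x) then 1 else 0)
    one x with does (P? x)
    ... | true  = refl
    ... | false = refl
  go : ∀ n → length (filter P? (applyUpTo suc n)) ≡ count (λ i → does (P? i)) n
  go zero    = refl
  go (suc n) = trans (snoc suc n) (cong (_+ _) (go n))

count-cong : ∀ (b b′ : ℕ → Bool) n → (∀ i → 1 ≤ i → i ≤ n → b i ≡ b′ i) → count b n ≡ count b′ n
count-cong b b′ zero    h = refl
count-cong b b′ (suc n) h = cong₂ _+_ (count-cong b b′ n (λ i a c → h i a (ℕP.m≤n⇒m≤1+n c)))
  (cong (λ x → if x then 1 else 0) (h (suc n) (s≤s z≤n) ℕP.≤-refl))

count-vanishing-tail : ∀ (b : ℕ → Bool) n m → n ≤ m → (∀ i → n < i → b i ≡ false) → count b m ≡ count b n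
count-vanishing-tail b n m n≤m vanish = trans (cong (count b) (sym (ℕP.m∸n+n≡m n≤m))) (go (m ∸ n))
  where
  go : ∀ k → count b (k + n) ≡ count b n
  go zero    = refl
  go (suc k) rewrite vanish (suc (k + n)) (s≤s (ℕP.m≤n+m n k)) = trans (ℕP.+-identityʳ _) (go k)

count-split : ∀ (b b₁ : ℕ → Bool) p n → (∀ i → i ≢ p → b i ≡ b₁ i) → b p ≡ true → b₁ p ≡ false →
  1 ≤ p → p ≤ n → count b n ≡ suc (count b₁ n)
count-split b b₁ (suc p) zero h bp b₁p _ ()
count-split b b₁ p (suc n) h bp b₁p 1≤p p≤n with suc n ℕP.≟ p
... | yes refl rewrite bp | b₁p =
  trans (cong (_+ 1) (count-cong b b₁ n (λ i _ i≤n → h i (λ e → ℕP.<-irrefl e (s≤s i≤n)))))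
        (trans (ℕP.+-comm _ 1) (cong suc (sym (ℕP.+-identityʳ _))))
... | no n≢p rewrite h (suc n) n≢p =
  cong (_+ _) (count-split b b₁ p n h bp b₁p 1≤p (ℕ.s≤s⁻¹ (ℕP.≤∧≢⇒< p≤n (λ e → n≢p (sym e)))))

filter-filter : ∀ {P Q : ℕ → Set} (P? : Decidable P) (Q? : Decidable Q) xs →
  filter P? (filter Q? xs) ≡ filter (λ x → Q? x ×-dec P? x) xs
filter-filter P? Q? [] = refl
filter-filter P? Q? (x ∷ xs) with does (Q? x)
... | false = filter-filter P? Q? xs
... | true with does (P? x)
...   | true  = cong (x ∷_) (filter-filter P? Q? xs)
...   | false = filter-filter P? Q? xs

SquareFree : ℕ → Set
SquareFree n = ∀ m → 2 ≤ m → m * m ∣ n → ⊥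

and-applyUpTo⁺ : ∀ (f : ℕ → Bool) n → (∀ i → i < n → f i ≡ true) → foldr _∧_ true (applyUpTo f n) ≡ true
and-applyUpTo⁺ f zero    h = refl
and-applyUpTo⁺ f (suc n) h rewrite h 0 (s≤s z≤n) = and-applyUpTo⁺ (f ∘ suc) n (λ i lt → h (suc i) (s≤s lt))

and-applyUpTo⁻ : ∀ (f : ℕ → Bool) n → foldr _∧_ true (applyUpTo f n) ≡ true → ∀ i → i < n → f i ≡ true
and-applyUpTo⁻ f (suc n) eq i lt with f 0 in f0
and-applyUpTo⁻ f (suc n) eq zero    lt        | true = f0
and-applyUpTo⁻ f (suc n) eq (suc i) (s≤s lt) | true = and-applyUpTo⁻ (f ∘ suc) n eq i lt

squarefree⇒SquareFree : ∀ n → 1 ≤ n → squarefree n ≡ true → SquareFree n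
squarefree⇒SquareFree n 1≤n eq (suc zero)    (s≤s ()) dv
squarefree⇒SquareFree n 1≤n eq (suc (suc i)) _        dv =
  not⌊⌋⇒¬ ((suc (suc i) * suc (suc i)) ∣? n)
    (and-applyUpTo⁻ _ n (trans (sym (cong (foldr _∧_ true) (map-oneTo _ n))) eq) i i<n) dv
  where
  -- the square m² = (i + 2)² dividing n is at most n, so its test is in the list
  i<n : i < n
  i<n = ℕP.<-≤-trans (ℕP.<-trans (ℕP.n<1+n i) (ℕP.n<1+n (suc i)))
          (ℕP.≤-trans (ℕP.m≤m*n (suc (suc i)) (suc (suc i))) (∣⇒≤ {{ℕ.>-nonZero 1≤n}} dv))
  not⌊⌋⇒¬ : ∀ {A : Set} (a? : Dec A) → not ⌊ a? ⌋ ≡ true → ¬ A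
  not⌊⌋⇒¬ (yes _) ()
  not⌊⌋⇒¬ (no ¬a) _ = ¬a

SquareFree⇒squarefree : ∀ n → SquareFree n → squarefree n ≡ true
SquareFree⇒squarefree n sf = trans (cong (foldr _∧_ true) (map-oneTo _ n))
  (and-applyUpTo⁺ _ n λ i _ → cong not (trans (isYes≗does _)
    (dec-false ((suc (suc i) * suc (suc i)) ∣? n) (sf (suc (suc i)) (s≤s (s≤s z≤n))))))

¬SquareFree⇒squarefree : ∀ n → 1 ≤ n → ¬ SquareFree n → squarefree n ≡ false
¬SquareFree⇒squarefree n 1≤n ¬sf with squarefree n in e
... | true  = ⊥-elim (¬sf (squarefree⇒SquareFree n 1≤n e))
... | false = refl

prime≥2 : ∀ {p} → Prime p → 2 ≤ p
prime≥2 {p} pp = ℕ.nonTrivial⇒n>1 p {{prime⇒nonTrivial pp}}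

prime≥1 : ∀ {p} → Prime p → 1 ≤ p
prime≥1 pp = ℕP.<⇒≤ (prime≥2 pp)

coprime-prime : ∀ {p d} → Prime p → ¬ p ∣ d → Coprime d p
coprime-prime pp ¬p∣d (i∣d , i∣p) with prime⇒irreducible pp i∣p
... | inj₁ i≡1 = i≡1
... | inj₂ refl = ⊥-elim (¬p∣d i∣d)

SquareFree-* : ∀ {p d} → Prime p → ¬ p ∣ d → SquareFree d → SquareFree (p * d)
SquareFree-* {p} {d} pp ¬p∣d sf m 2≤m mm∣pd with p ∣? m
... | no ¬p∣m = sf m 2≤m (coprime-divisor (coprime-prime pp ¬p∣mm) mm∣pd)
  where
  ¬p∣mm : ¬ p ∣ m * m
  ¬p∣mm p∣mm = [ ¬p∣m , ¬p∣m ] (euclidsLemma m m pp p∣mm)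
... | yes (divides c refl) =
  ¬p∣d (*-cancelˡ-∣ p {{prime⇒nonZero pp}} (∣-trans (*-pres-∣ (n∣m*n c) (n∣m*n c)) mm∣pd))

SquareFree-*⁻ : ∀ {p d} → SquareFree (p * d) → SquareFree d
SquareFree-*⁻ {p} sf m 2≤m mm∣d = sf m 2≤m (∣-trans mm∣d (n∣m*n p))

¬SquareFree-* : ∀ {p d} → Prime p → p ∣ d → ¬ SquareFree (p * d)
¬SquareFree-* {p} pp p∣d sf = sf p (prime≥2 pp) (*-monoʳ-∣ p p∣d)

numPrimeDivisors-count : ∀ n → numPrimeDivisors n ≡ count (λ i → does (i ∣? n) ∧ does (prime? i)) n
numPrimeDivisors-count n =
  trans (cong length (filter-filter prime? (_∣? n) (oneTo n))) (length-filter-oneTo (λ x → (x ∣? n) ×-dec prime? x) n)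

numPrimeDivisors-* : ∀ {p d} → Prime p → ¬ p ∣ d → 1 ≤ d →
  numPrimeDivisors (p * d) ≡ suc (numPrimeDivisors d)
numPrimeDivisors-* {p} {d} pp ¬p∣d 1≤d = begin
  numPrimeDivisors (p * d) ≡⟨ numPrimeDivisors-count (p * d) ⟩
  count b (p * d)          ≡⟨ count-split b b₁ p (p * d) same bp b₁p (prime≥1 pp) p≤pd ⟩
  suc (count b₁ (p * d))   ≡⟨ cong suc (count-vanishing-tail b₁ d (p * d) d≤pd vanish) ⟩
  suc (count b₁ d)         ≡⟨ cong suc (sym (numPrimeDivisors-count d)) ⟩
  suc (numPrimeDivisors d) ∎
  where
  open ≡-Reasoning
  b b₁ : ℕ → Bool
  b  i = does (i ∣? (p * d)) ∧ does (prime? i)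
  b₁ i = does (i ∣? d) ∧ does (prime? i)
  p≤pd : p ≤ p * d
  p≤pd = ℕP.m≤m*n p d {{ℕ.>-nonZero 1≤d}}
  d≤pd : d ≤ p * d
  d≤pd = ℕP.m≤n*m d p {{prime⇒nonZero pp}}
  prime∣pd⇒∣d : ∀ {i} → i ≢ p → Prime i → i ∣ p * d → i ∣ d
  prime∣pd⇒∣d i≢p pi i∣pd with euclidsLemma p d pi i∣pd
  ... | inj₂ i∣d = i∣d
  ... | inj₁ i∣p with prime⇒irreducible pp i∣p
  ...   | inj₂ i≡p  = ⊥-elim (i≢p i≡p)
  ...   | inj₁ refl = ⊥-elim (¬prime[1] pi)
  same : ∀ i → i ≢ p → b i ≡ b₁ i
  same i i≢p with prime? i
  ... | no _   = trans (∧-zeroʳ _) (sym (∧-zeroʳ _))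
  ... | yes pi = cong (_∧ true) (does-⇔ (mk⇔ (prime∣pd⇒∣d i≢p pi) (λ x → ∣-trans x (n∣m*n p))) (i ∣? (p * d)) (i ∣? d))
  bp : b p ≡ true
  bp = cong₂ _∧_ (dec-true (p ∣? (p * d)) (m∣m*n d)) (dec-true (prime? p) pp)
  b₁p : b₁ p ≡ false
  b₁p = cong (_∧ does (prime? p)) (dec-false (p ∣? d) ¬p∣d)
  vanish : ∀ i → d < i → b₁ i ≡ false
  vanish i d<i = cong (_∧ does (prime? i)) (dec-false (i ∣? d) (λ x → ℕP.<⇒≱ d<i (∣⇒≤ {{ℕ.>-nonZero 1≤d}} x)))

squarefree-* : ∀ {p d} → Prime p → ¬ p ∣ d → 1 ≤ d → squarefree (p * d) ≡ squarefree d
squarefree-* {p} {d} pp ¬p∣d 1≤d with squarefree d in e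
... | true  = SquareFree⇒squarefree (p * d) (SquareFree-* pp ¬p∣d (squarefree⇒SquareFree d 1≤d e))
... | false = ¬SquareFree⇒squarefree (p * d) (ℕP.*-mono-≤ (prime≥1 pp) 1≤d)
  (λ sf → case trans (sym e) (SquareFree⇒squarefree d (SquareFree-*⁻ {p} sf)) of λ ())

μℚ : ℕ → ℚ
μℚ d = μ d ℚ./ 1

μℚ-* : ∀ {p d} → Prime p → ¬ p ∣ d → 1 ≤ d → μℚ (p * d) ≡ ℚ.- μℚ d
μℚ-* {p} {d} pp ¬p∣d 1≤d = trans (cong (ℚ._/ 1) μ-*) (neg/1 (μ d))
  where
  μ-* : μ (p * d) ≡ ℤ.- μ d
  μ-* rewrite squarefree-* pp ¬p∣d 1≤d | numPrimeDivisors-* pp ¬p∣d 1≤d with squarefree d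
  ... | true  = ℤP.-1*i≡-i _
  ... | false = refl
  neg/1 : ∀ z → (ℤ.- z) ℚ./ 1 ≡ ℚ.- (z ℚ./ 1)
  neg/1 (+ zero)    = refl
  neg/1 (+ suc n)   = refl
  neg/1 ℤ.-[1+ n ] = sym (⁻¹-involutive _)

μℚ-*-∣ : ∀ {p d} → Prime p → p ∣ d → 1 ≤ d → μℚ (p * d) ≡ 0ℚ
μℚ-*-∣ {p} {d} pp p∣d 1≤d
  rewrite ¬SquareFree⇒squarefree (p * d) (ℕP.*-mono-≤ (prime≥1 pp) 1≤d) (¬SquareFree-* pp p∣d) = refl

Σ-divisors : ℕ → (ℕ → ℚ) → ℚ
Σ-divisors s g = Σ (λ d → if does (d ∣? s) then g d else 0ℚ) s

Σ-multiples : ∀ (G : ℕ → ℚ) p → 1 ≤ p → ∀ t →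
  Σ (λ d → if does (p ∣? d) then G d else 0ℚ) (p * t) ≡ Σ (λ j → G (p * j)) t
Σ-multiples G p 1≤p zero rewrite ℕP.*-zeroʳ p = refl
Σ-multiples G p@(suc p′) 1≤p (suc t) =
  trans (cong (Σ g) (ℕP.*-suc p t))
  (trans (Σ-split g (p * t) p) (cong₂ ℚ._+_ (Σ-multiples G p 1≤p t) block))
  where
  g : ℕ → ℚ
  g d = if does (p ∣? d) then G d else 0ℚ
  -- in the block p t + 1, …, p t + p only the last index is a multiple of p
  block : Σ (λ i → g (i + p * t)) p ≡ G (p * suc t)
  block = trans (Σ-last _ p′ vanish)
    (trans (if-true (dec-true (p ∣? (p + p * t)) (∣m∣n⇒∣m+n ∣-refl (m∣m*n t)))) (cong G (sym (ℕP.*-suc p t))))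
    where
    vanish : ∀ i → 1 ≤ i → i < p → g (i + p * t) ≡ 0ℚ
    vanish i 1≤i i<p = if-false (dec-false (p ∣? (i + p * t)) λ p∣ → ℕP.<⇒≱ i<p
      (∣⇒≤ {{ℕ.>-nonZero 1≤i}} (∣m+n∣m⇒∣n (subst (p ∣_) (ℕP.+-comm i (p * t)) p∣) (m∣m*n t))))

prime-factor : ∀ s → 2 ≤ s → ∃ λ p → Prime p × p ∣ s
prime-factor (suc zero) (s≤s ())
prime-factor s@(suc (suc _)) _ with factorise s
... | record { factors = p ∷ ps ; isFactorisation = eq ; factorsPrime = pp ∷ _ } =
  p , pp , subst (p ∣_) (sym eq) (m∣m*n (product ps))

μ-sum : ℕ → ℚ
μ-sum s = Σ-divisors s μℚ

-- For a prime p, the divisors of p t split into the multiples p j (j ∣ t) and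
-- those prime to p (the divisors d of t with p ∤ d).  Writing ν(d) for μ(d)
-- restricted to divisors of t prime to p, the multiples contribute - Σ ν
-- (since μ(p j) = - μ(j) for p ∤ j and 0 for p ∣ j), and the others Σ ν.
module _ (p t : ℕ) (pp : Prime p) (1≤t : 1 ≤ t) where

  private
    s = p * t
    μ∣s ν : ℕ → ℚ
    μ∣s d = if does (d ∣? s) then μℚ d else 0ℚ
    ν   d = if does (p ∣? d) then 0ℚ else (if does (d ∣? t) then μℚ d else 0ℚ)
    ∣s⇔∣t : ∀ d → ¬ p ∣ d → does (d ∣? s) ≡ does (d ∣? t)
    ∣s⇔∣t d ¬p∣d = does-⇔ (mk⇔ (coprime-divisor (coprime-prime pp ¬p∣d)) (λ x → ∣-trans x (n∣m*n p))) (d ∣? s) (d ∣? t)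

  Σ-multiples-of-p : Σ (λ d → if does (p ∣? d) then μ∣s d else 0ℚ) s ≡ ℚ.- Σ ν t
  Σ-multiples-of-p = trans (Σ-multiples μ∣s p (prime≥1 pp) t) (trans (Σ-cong-on t term) (Σ-neg ν t))
    where
    term : ∀ j → 1 ≤ j → j ≤ t → μ∣s (p * j) ≡ ℚ.- ν j
    term j 1≤j _ rewrite does-⇔ (mk⇔ (*-cancelˡ-∣ p {{prime⇒nonZero pp}}) (*-monoʳ-∣ p)) ((p * j) ∣? s) (j ∣? t)
      with j ∣? t | p ∣? j
    ... | no _  | yes _    = refl
    ... | no _  | no _     = refl
    ... | yes _ | yes p∣j  = μℚ-*-∣ pp p∣j 1≤j
    ... | yes _ | no ¬p∣j  = μℚ-* pp ¬p∣j 1≤j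

  Σ-prime-to-p : Σ (λ d → if does (p ∣? d) then 0ℚ else μ∣s d) s ≡ Σ ν t
  Σ-prime-to-p = trans (Σ-vanishing-tail _ t s (ℕP.m≤n*m t p {{prime⇒nonZero pp}}) vanish) (Σ-cong t same)
    where
    vanish : ∀ i → t < i → (if does (p ∣? i) then 0ℚ else μ∣s i) ≡ 0ℚ
    vanish i t<i with p ∣? i
    ... | yes _ = refl
    ... | no ¬p∣i rewrite ∣s⇔∣t i ¬p∣i =
      if-false (dec-false (i ∣? t) (λ x → ℕP.<⇒≱ t<i (∣⇒≤ {{ℕ.>-nonZero 1≤t}} x)))
    same : ∀ d → (if does (p ∣? d) then 0ℚ else μ∣s d) ≡ ν d
    same d with p ∣? d
    ... | yes _   = refl
    ... | no ¬p∣d rewrite ∣s⇔∣t d ¬p∣d = refl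

  μ-sum-prime-multiple : μ-sum (p * t) ≡ 0ℚ
  μ-sum-prime-multiple = begin
    Σ μ∣s s                     ≡⟨ Σ-cong s split ⟩
    Σ (λ d → A d ℚ.+ B d) s     ≡⟨ Σ-+ A B s ⟩
    Σ A s ℚ.+ Σ B s             ≡⟨ cong₂ ℚ._+_ Σ-multiples-of-p Σ-prime-to-p ⟩
    ℚ.- Σ ν t ℚ.+ Σ ν t         ≡⟨ ℚP.+-inverseˡ (Σ ν t) ⟩
    0ℚ                          ∎
    where
    open ≡-Reasoning
    A B : ℕ → ℚ
    A d = if does (p ∣? d) then μ∣s d else 0ℚ
    B d = if does (p ∣? d) then 0ℚ else μ∣s d
    split : ∀ d → μ∣s d ≡ A d ℚ.+ B d
    split d with does (p ∣? d)
    ... | true  = sym (ℚP.+-identityʳ _)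
    ... | false = sym (ℚP.+-identityˡ _)

μ-sum-≥2 : ∀ s → 2 ≤ s → μ-sum s ≡ 0ℚ
μ-sum-≥2 s 2≤s with prime-factor s 2≤s
... | p , pp , divides (suc t) s≡ =
  subst (λ x → μ-sum x ≡ 0ℚ) (sym (trans s≡ (ℕP.*-comm (suc t) p))) (μ-sum-prime-multiple p (suc t) pp (s≤s z≤n))
... | p , pp , divides zero s≡ = ⊥-elim (ℕP.<⇒≱ 2≤s (ℕP.≤-trans (ℕP.≤-reflexive s≡) z≤n))

μ-sum-nonneg : ∀ s → 1 ≤ s → 0ℚ ℚ.≤ μ-sum s
μ-sum-nonneg (suc zero)    _ = ℚP.nonNegative⁻¹ 1ℚ
μ-sum-nonneg (suc (suc s)) _ = ℚP.≤-reflexive (sym (μ-sum-≥2 (suc (suc s)) (s≤s (s≤s z≤n))))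

-- Multiplicative orders, phrased without modular arithmetic.
-- n ^ m ≡ 1 (mod k), written as a divisibility so that it makes sense for every k.
PowIsOne : (k n m : ℕ) → Set
PowIsOne k n m = k ∣ n ^ m ∸ 1

pow-split : ∀ n a b .{{_ : NonZero n}} → n ^ (a + b) ∸ 1 ≡ n ^ b * (n ^ a ∸ 1) + (n ^ b ∸ 1)
pow-split n a b = begin
  n ^ (a + b) ∸ 1         ≡⟨ cong (_∸ 1) (trans (ℕP.^-distribˡ-+-* n a b) (ℕP.*-comm (n ^ a) (n ^ b))) ⟩
  X * Y ∸ 1               ≡⟨ cong (_∸ 1) (sym (ℕP.m∸n+n≡m X≤XY)) ⟩
  (X * Y ∸ X) + X ∸ 1     ≡⟨ ℕP.+-∸-assoc (X * Y ∸ X) (ℕP.m^n>0 n b) ⟩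
  (X * Y ∸ X) + (X ∸ 1)   ≡⟨ cong (_+ (X ∸ 1)) (cong (X * Y ∸_) (ℕP.*-identityʳ X)) ⟨
  (X * Y ∸ X * 1) + (X ∸ 1) ≡⟨ cong (_+ (X ∸ 1)) (ℕP.*-distribˡ-∸ X Y 1) ⟨
  X * (Y ∸ 1) + (X ∸ 1)   ∎
  where
  open ≡-Reasoning
  X = n ^ b
  Y = n ^ a
  X≤XY : X ≤ X * Y
  X≤XY = ℕP.m≤m*n X Y {{ℕ.>-nonZero (ℕP.m^n>0 n a)}}

module _ (k n : ℕ) .{{_ : NonZero n}} where

  PowIsOne-+ : ∀ a b → PowIsOne k n a → PowIsOne k n b → PowIsOne k n (a + b)
  PowIsOne-+ a b ta tb = subst (k ∣_) (sym (pow-split n a b)) (∣m∣n⇒∣m+n (∣-trans ta (n∣m*n (n ^ b))) tb)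

  PowIsOne-∸ : ∀ a b → PowIsOne k n (a + b) → PowIsOne k n a → PowIsOne k n b
  PowIsOne-∸ a b tab ta = ∣m+n∣m⇒∣n (subst (k ∣_) (pow-split n a b) tab) (∣-trans ta (n∣m*n (n ^ b)))

  PowIsOne-* : ∀ o → PowIsOne k n o → ∀ c → PowIsOne k n (c * o)
  PowIsOne-* o to zero    = k ∣0
  PowIsOne-* o to (suc c) = PowIsOne-+ o (c * o) to (PowIsOne-* o to c)

  PowIsOne-% : ∀ m o .{{_ : NonZero o}} → PowIsOne k n m → PowIsOne k n o → PowIsOne k n (m % o)
  PowIsOne-% m o tm to = PowIsOne-∸ ((m / o) * o) (m % o)
    (subst (PowIsOne k n) (trans (m≡m%n+[m/n]*n m o) (ℕP.+-comm (m % o) _)) tm) (PowIsOne-* o to (m / o))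

Least : (ℕ → Set) → ℕ → Set
Least P o = 1 ≤ o × P o × (∀ m → 1 ≤ m → m < o → ¬ P m)

least-witness : ∀ {P : ℕ → Set} → Decidable P → ∀ r → 1 ≤ r → P r → ∃ λ o → o ≤ r × Least P o
least-witness {P} P? r 1≤r pr with search (suc r)
  where
  search : ∀ b → (∀ m → 1 ≤ m → m < b → ¬ P m) ⊎ (∃ λ o → o < b × Least P o)
  search zero = inj₁ (λ m _ ())
  search (suc b) with search b
  ... | inj₂ (o , o<b , least) = inj₂ (o , ℕP.m≤n⇒m≤1+n o<b , least)
  ... | inj₁ none with b | P? b
  ...   | zero   | _      = inj₁ (λ { m 1≤m (s≤s m≤0) _ → ℕP.<⇒≱ 1≤m m≤0 })
  ...   | suc b′ | yes pb = inj₂ (suc b′ , ℕP.≤-refl , s≤s z≤n , pb , none)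
  ...   | suc b′ | no ¬pb = inj₁ λ m 1≤m m<b pm → case m ℕP.≟ suc b′ of λ where
          (yes refl) → ¬pb pm
          (no m≢b)   → none m 1≤m (ℕP.≤∧≢⇒< (ℕ.s≤s⁻¹ m<b) m≢b) pm
... | inj₁ none             = ⊥-elim (none r 1≤r ℕP.≤-refl pr)
... | inj₂ (o , o<r , least) = o , ℕ.s≤s⁻¹ o<r , least

module _ (k n : ℕ) .{{_ : NonZero n}} where

  private
    swap : ∀ a b c → a * b * c ≡ a * c * b
    swap = solve-∀

  order-divides : ∀ o → Least (PowIsOne k n) o → ∀ m → PowIsOne k n m → o ∣ m
  order-divides o (1≤o , to , below) m tm = m%n≡0⇒n∣m m o (remainder-zero (m % o) refl)
    where
    instance _ = ℕ.>-nonZero 1≤o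
    remainder-zero : ∀ x → m % o ≡ x → x ≡ 0
    remainder-zero zero    _ = refl
    remainder-zero (suc x) e = ⊥-elim (below (suc x) (s≤s z≤n) (subst (_< o) e (m%n<n m o))
      (subst (PowIsOne k n) e (PowIsOne-% k n m o tm to)))

  cofactor-divides : ∀ r o → Least (PowIsOne k n) o → ∀ s → r ≡ s * o →
    ∀ d e → r ≡ e * d → PowIsOne k n e → d ∣ s
  cofactor-divides r o least@(1≤o , _ , _) s r≡so d e r≡ed te with order-divides o least e te
  ... | divides c e≡co = divides c (ℕP.*-cancelʳ-≡ s (c * d) o {{ℕ.>-nonZero 1≤o}}
    (trans (sym r≡so) (trans r≡ed (trans (cong (_* d) e≡co) (swap c o d)))))

  divides-cofactor : ∀ r o → Least (PowIsOne k n) o → ∀ s → r ≡ s * o →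
    ∀ d e .{{_ : NonZero d}} → r ≡ e * d → d ∣ s → PowIsOne k n e
  divides-cofactor r o (_ , to , _) s r≡so d e r≡ed (divides c s≡cd) =
    subst (PowIsOne k n) (sym e≡co) (PowIsOne-* k n o to c)
    where
    e≡co : e ≡ c * o
    e≡co = ℕP.*-cancelʳ-≡ e (c * o) d (trans (sym r≡ed) (trans r≡so (trans (cong (_* o) s≡cd) (swap c d o))))

ι : Bool → ℚ
ι b = if b then 1ℚ else 0ℚ

*ι : ∀ x b → x ℚ.* ι b ≡ (if b then x else 0ℚ)
*ι x true  = ℚP.*-identityʳ x
*ι x false = ℚP.*-zeroʳ x

ι-nonneg : ∀ b → 0ℚ ℚ.≤ ι b
ι-nonneg true  = ℚP.nonNegative⁻¹ 1ℚ
ι-nonneg false = ℚP.≤-refl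

-- W k n r = Σ_{d ∣ r} μ(d) [n^(r/d) ≡ 1 (mod k)], the Möbius inversion of the
-- condition n^r ≡ 1 (mod k); it equals 1 when n has order exactly r mod k.
W-term : ℕ → ℕ → ℕ → ℕ → ℚ
W-term k n r d = μℚ d ℚ.* ι (does (k ∣? (n ^ (r / suc (d ∸ 1)) ∸ 1)))

W : ℕ → ℕ → ℕ → ℚ
W k n r = Σ-divisors r (W-term k n r)

W-term-divisor : ∀ k n r e d′ → r ≡ e * suc d′ → W-term k n r (suc d′) ≡ μℚ (suc d′) ℚ.* ι (does (k ∣? (n ^ e ∸ 1)))
W-term-divisor k n r e d′ r≡ =
  cong (λ x → μℚ (suc d′) ℚ.* ι (does (k ∣? (n ^ x ∸ 1)))) (trans (/-congˡ r≡) (m*n/n≡m e (suc d′)))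

positive-cofactor : ∀ {r s o} → 1 ≤ r → r ≡ s * o → 1 ≤ s
positive-cofactor {s = zero}  1≤r r≡0 = ⊥-elim (ℕP.<⇒≱ 1≤r (ℕP.≤-reflexive r≡0))
positive-cofactor {s = suc _} _   _   = s≤s z≤n

module _ (k n : ℕ) .{{_ : NonZero n}} where

  -- If n^r ≢ 1 (mod k), no divisor of r works either, so W vanishes.
  W-not-PowIsOne : ∀ r → ¬ PowIsOne k n r → W k n r ≡ 0ℚ
  W-not-PowIsOne r ¬tr = trans (Σ-cong-on r term) (Σ-zero r)
    where
    term : ∀ d → 1 ≤ d → d ≤ r → (if does (d ∣? r) then W-term k n r d else 0ℚ) ≡ 0ℚ
    term (suc d′) _ _ with suc d′ ∣? r
    ... | no ¬d∣r = if-false (dec-false (suc d′ ∣? r) ¬d∣r)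
    ... | yes d∣r@(divides e r≡) = begin
      (if does (suc d′ ∣? r) then W-term k n r (suc d′) else 0ℚ) ≡⟨ if-true (dec-true (suc d′ ∣? r) d∣r) ⟩
      W-term k n r (suc d′)                        ≡⟨ W-term-divisor k n r e d′ r≡ ⟩
      μℚ (suc d′) ℚ.* ι (does (k ∣? (n ^ e ∸ 1)))  ≡⟨ cong (λ b → μℚ (suc d′) ℚ.* ι b) test-false ⟩
      μℚ (suc d′) ℚ.* 0ℚ                           ≡⟨ ℚP.*-zeroʳ (μℚ (suc d′)) ⟩
      0ℚ                                           ∎
      where
      open ≡-Reasoning
      ¬te : ¬ PowIsOne k n e
      ¬te te = ¬tr (subst (PowIsOne k n) (sym (trans r≡ (ℕP.*-comm e (suc d′)))) (PowIsOne-* k n e te (suc d′)))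
      test-false : does (k ∣? (n ^ e ∸ 1)) ≡ false
      test-false = dec-false (k ∣? (n ^ e ∸ 1)) ¬te

  W-order : ∀ r → 1 ≤ r → ∀ o → Least (PowIsOne k n) o → ∀ s → r ≡ s * o → W k n r ≡ μ-sum s
  W-order r 1≤r o least@(1≤o , _ , _) s r≡so =
    trans (Σ-cong-on r term) (Σ-vanishing-tail _ s r s≤r vanish)
    where
    1≤s : 1 ≤ s
    1≤s = positive-cofactor 1≤r r≡so
    s≤r : s ≤ r
    s≤r = subst (s ≤_) (sym r≡so) (ℕP.m≤m*n s o {{ℕ.>-nonZero 1≤o}})
    vanish : ∀ d → s < d → (if does (d ∣? s) then μℚ d else 0ℚ) ≡ 0ℚ
    vanish d s<d = if-false (dec-false (d ∣? s) (λ x → ℕP.<⇒≱ s<d (∣⇒≤ {{ℕ.>-nonZero 1≤s}} x)))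
    term : ∀ d → 1 ≤ d → d ≤ r → (if does (d ∣? r) then W-term k n r d else 0ℚ) ≡ (if does (d ∣? s) then μℚ d else 0ℚ)
    term (suc d′) _ _ with suc d′ ∣? r
    ... | no ¬d∣r = trans (if-false (dec-false (suc d′ ∣? r) ¬d∣r)) (sym (if-false (dec-false (suc d′ ∣? s)
          (λ d∣s → ¬d∣r (subst (suc d′ ∣_) (sym r≡so) (∣-trans d∣s (m∣m*n o)))))))
    ... | yes d∣r@(divides e r≡) = begin
      (if does (suc d′ ∣? r) then W-term k n r (suc d′) else 0ℚ) ≡⟨ if-true (dec-true (suc d′ ∣? r) d∣r) ⟩
      W-term k n r (suc d′)                        ≡⟨ W-term-divisor k n r e d′ r≡ ⟩
      μℚ (suc d′) ℚ.* ι (does (k ∣? (n ^ e ∸ 1)))  ≡⟨ cong (λ b → μℚ (suc d′) ℚ.* ι b) test-equal ⟩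
      μℚ (suc d′) ℚ.* ι (does (suc d′ ∣? s))       ≡⟨ *ι (μℚ (suc d′)) _ ⟩
      (if does (suc d′ ∣? s) then μℚ (suc d′) else 0ℚ) ∎
      where
      open ≡-Reasoning
      test-equal : does (k ∣? (n ^ e ∸ 1)) ≡ does (suc d′ ∣? s)
      test-equal = does-⇔ (mk⇔ (cofactor-divides k n r o least s r≡so (suc d′) e r≡)
                                (divides-cofactor k n r o least s r≡so (suc d′) e r≡))
                          (k ∣? (n ^ e ∸ 1)) (suc d′ ∣? s)

  W-nonneg : ∀ r → 1 ≤ r → 0ℚ ℚ.≤ W k n r
  W-nonneg r 1≤r with k ∣? (n ^ r ∸ 1)
  ... | no ¬tr = ℚP.≤-reflexive (sym (W-not-PowIsOne r ¬tr))
  ... | yes tr with least-witness (λ m → k ∣? (n ^ m ∸ 1)) r 1≤r tr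
  ...   | o , _ , least with order-divides k n o least r tr
  ...     | divides s r≡so = subst (0ℚ ℚ.≤_) (sym (W-order r 1≤r o least s r≡so)) (μ-sum-nonneg s (positive-cofactor 1≤r r≡so))

  W-exact-order : ∀ r → Least (PowIsOne k n) r → W k n r ≡ 1ℚ
  W-exact-order r least@(1≤r , _ , _) = W-order r 1≤r r least 1 (sym (ℕP.*-identityˡ r))

gcd≡1-∣ : ∀ {k c q} → k ∣ c → gcd c q ≡ 1 → gcd k q ≡ 1
gcd≡1-∣ {k} {c} {q} k∣c g =
  ∣1⇒≡1 (subst (gcd k q ∣_) g (gcd-greatest (∣-trans (gcd[m,n]∣m k q) k∣c) (gcd[m,n]∣n k q)))

gcd≡1-* : ∀ {k c q} → gcd k q ≡ 1 → gcd c q ≡ 1 → gcd (k * c) q ≡ 1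
gcd≡1-* {k} {c} {q} gk gc = ∣1⇒≡1 (subst (g ∣_) gc (gcd-greatest g∣c (gcd[m,n]∣n (k * c) q)))
  where
  g = gcd (k * c) q
  g⊥k : Coprime g k
  g⊥k (i∣g , i∣k) = ∣1⇒≡1 (subst (_ ∣_) gk (gcd-greatest i∣k (∣-trans i∣g (gcd[m,n]∣n (k * c) q))))
  g∣c : g ∣ c
  g∣c = coprime-divisor g⊥k (gcd[m,n]∣m (k * c) q)

data IsLargest (R : ℕ → Set) (N : ℕ) : Maybe ℕ → Set where
  none : (∀ i → 1 ≤ i → i ≤ N → ¬ R i) → IsLargest R N nothing
  some : ∀ c → 1 ≤ c → c ≤ N → R c → (∀ i → 1 ≤ i → i ≤ N → R i → i ≤ c) → IsLargest R N (just c)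

last-filter-oneTo : ∀ {R : ℕ → Set} (R? : Decidable R) N → IsLargest R N (last (filter R? (oneTo N)))
last-filter-oneTo R? zero = none (λ i 1≤i i≤0 _ → ℕP.<⇒≱ 1≤i i≤0)
last-filter-oneTo {R} R? (suc N) = subst (IsLargest R (suc N)) (sym last≡) (step (R? (suc N)))
  where
  last-∷ʳ : ∀ (ys : List ℕ) x → last (ys ∷ʳ x) ≡ just x
  last-∷ʳ []           x = refl
  last-∷ʳ (y ∷ [])     x = refl
  last-∷ʳ (y ∷ y′ ∷ ys) x = last-∷ʳ (y′ ∷ ys) x
  last-++-[] : ∀ (ys : List ℕ) → last (ys ++ []) ≡ last ys
  last-++-[] []           = refl
  last-++-[] (y ∷ [])     = refl
  last-++-[] (y ∷ y′ ∷ ys) = last-++-[] (y′ ∷ ys)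
  oneTo-∷ʳ : oneTo (suc N) ≡ oneTo N ∷ʳ suc N
  oneTo-∷ʳ = trans (map-upTo suc (suc N)) (trans (sym (applyUpTo-∷ʳ suc N)) (cong (_∷ʳ suc N) (sym (map-upTo suc N))))
  last≡ : last (filter R? (oneTo (suc N))) ≡ last (filter R? (oneTo N) ++ filter R? (suc N ∷ []))
  last≡ = cong last (trans (cong (filter R?) oneTo-∷ʳ) (filter-++ R? (oneTo N) (suc N ∷ [])))
  extend : ∀ {m} → IsLargest R N m → ¬ R (suc N) → IsLargest R (suc N) m
  extend (none below) ¬r = none λ i 1≤i i≤ ri → case i ℕP.≟ suc N of λ where
    (yes refl) → ¬r ri
    (no i≢)    → below i 1≤i (ℕ.s≤s⁻¹ (ℕP.≤∧≢⇒< i≤ i≢)) ri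
  extend (some c 1≤c c≤N rc largest) ¬r = some c 1≤c (ℕP.m≤n⇒m≤1+n c≤N) rc λ i 1≤i i≤ ri → case i ℕP.≟ suc N of λ where
    (yes refl) → ⊥-elim (¬r ri)
    (no i≢)    → largest i 1≤i (ℕ.s≤s⁻¹ (ℕP.≤∧≢⇒< i≤ i≢)) ri
  step : Dec (R (suc N)) → IsLargest R (suc N) (last (filter R? (oneTo N) ++ filter R? (suc N ∷ [])))
  step (yes r) with R? (suc N)
  ... | yes _ rewrite last-∷ʳ (filter R? (oneTo N)) (suc N) = some (suc N) (s≤s z≤n) ℕP.≤-refl r (λ i _ i≤ _ → i≤)
  ... | no ¬r = ⊥-elim (¬r r)
  step (no ¬r) with R? (suc N)
  ... | yes r = ⊥-elim (¬r r)
  ... | no _ rewrite last-++-[] (filter R? (oneTo N)) = extend (last-filter-oneTo R? N) ¬r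

divisor-positive : ∀ {d N} → 1 ≤ N → d ∣ N → 1 ≤ d
divisor-positive {zero}  1≤N 0∣N = ⊥-elim (ℕP.<⇒≱ 1≤N (ℕP.≤-reflexive (0∣⇒≡0 0∣N)))
divisor-positive {suc _} _   _   = s≤s z≤n

record IsCoprimePart (q N c : ℕ) : Set where
  field
    c∣N      : c ∣ N
    c⊥q      : gcd c q ≡ 1
    positive : 1 ≤ c
    largest  : ∀ d → d ∣ N → gcd d q ≡ 1 → d ≤ c

coprimePart-spec : ∀ q N → 1 ≤ N → IsCoprimePart q N (coprimePart q N)
coprimePart-spec q N 1≤N = from-largest (last-filter-oneTo R? N)
  where
  R? : Decidable (λ i → i ∣ N × gcd i q ≡ 1)
  R? i = (i ∣? N) ×-dec (gcd i q ℕP.≟ 1)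
  -- coprimePart is defined through last (filter R? (oneTo N)), up to filter-filter
  from-largest : IsLargest _ N (last (filter R? (oneTo N))) → IsCoprimePart q N (coprimePart q N)
  from-largest largest rewrite sym (filter-filter (λ d → gcd d q ℕP.≟ 1) (_∣? N) (oneTo N))
    with last (filter (λ d → gcd d q ℕP.≟ 1) (divisors N)) | largest
  ... | nothing | none below = ⊥-elim (below 1 ℕP.≤-refl 1≤N (1∣ N , gcd-zeroˡ q))
  ... | just c  | some .c 1≤c _ (c∣N , c⊥q) largest′ = record
    { c∣N = c∣N ; c⊥q = c⊥q ; positive = 1≤c
    ; largest = λ d d∣N d⊥q → largest′ d (divisor-positive 1≤N d∣N) (∣⇒≤ {{ℕ.>-nonZero 1≤N}} d∣N) (d∣N , d⊥q) }

∣coprimePart⇔ : ∀ q N k → 1 ≤ N →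
  (k ∣ coprimePart q N → k ∣ N × gcd k q ≡ 1) × (k ∣ N → gcd k q ≡ 1 → k ∣ coprimePart q N)
∣coprimePart⇔ q N k 1≤N = (λ k∣c → ∣-trans k∣c c∣N , gcd≡1-∣ k∣c c⊥q) , ⇐
  where
  open IsCoprimePart (coprimePart-spec q N 1≤N)
  c = coprimePart q N
  -- lcm(k, c) divides N and is prime to q, so by maximality it is c itself
  ⇐ : k ∣ N → gcd k q ≡ 1 → k ∣ c
  ⇐ k∣N k⊥q = subst (k ∣_) l≡c (m∣lcm[m,n] k c)
    where
    l = lcm k c
    l∣N : l ∣ N
    l∣N = lcm-least k∣N c∣N
    l⊥q : gcd l q ≡ 1
    l⊥q = gcd≡1-∣ {l} {k * c} (lcm-least {k} {c} (m∣m*n c) (n∣m*n k)) (gcd≡1-* {k} {c} k⊥q c⊥q)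
    l≡c : l ≡ c
    l≡c = ℕP.≤-antisym (largest l l∣N l⊥q) (∣⇒≤ {{ℕ.>-nonZero (divisor-positive 1≤N l∣N)}} (n∣lcm[m,n] k c))

φ/ord : ℕ → ℕ → ℚ
φ/ord q k = (+ φ k) ℚ./ suc (ordPred q k)

coprimeWeight : ℕ → ℕ → ℚ
coprimeWeight q k = φ/ord q k ℚ.* ι (does (gcd k q ℕP.≟ 1))

φ/ord-nonneg : ∀ q k → 0ℚ ℚ.≤ φ/ord q k
φ/ord-nonneg q k = ℚP.nonNegative⁻¹ _ {{ℚP.normalize-nonNeg (φ k) (suc (ordPred q k))}}

*-nonneg : ∀ x y → 0ℚ ℚ.≤ x → 0ℚ ℚ.≤ y → 0ℚ ℚ.≤ x ℚ.* y
*-nonneg x y 0≤x 0≤y =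
  ℚP.≤-trans (ℚP.≤-reflexive (sym (ℚP.*-zeroʳ x))) (ℚP.*-monoˡ-≤-nonNeg x {{ℚ.nonNegative 0≤x}} 0≤y)

coprimeWeight-nonneg : ∀ q k → 0ℚ ℚ.≤ coprimeWeight q k
coprimeWeight-nonneg q k = *-nonneg _ _ (φ/ord-nonneg q k) (ι-nonneg _)

if-∧ : ∀ (G : ℚ) b c g → b ≡ c ∧ g → (if b then G else 0ℚ) ≡ (G ℚ.* ι g) ℚ.* ι c
if-∧ G _ true  true  refl = sym (trans (ℚP.*-identityʳ _) (ℚP.*-identityʳ G))
if-∧ G _ true  false refl = sym (trans (ℚP.*-identityʳ _) (ℚP.*-zeroʳ G))
if-∧ G _ false g     refl = sym (ℚP.*-zeroʳ (G ℚ.* ι g))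

coprimePart-sum : ∀ q N B → 1 ≤ N → N ≤ B →
  sumℚ (map (φ/ord q) (divisors (coprimePart q N))) ≡ Σ (λ k → coprimeWeight q k ℚ.* ι (does (k ∣? N))) B
coprimePart-sum q N B 1≤N N≤B = begin
  sumℚ (map (φ/ord q) (divisors c))  ≡⟨ sumℚ-filter (_∣? c) (φ/ord q) (oneTo c) ⟩
  sumℚ (map g (oneTo c))             ≡⟨ sumℚ-oneTo g c ⟩
  Σ g c                              ≡⟨ Σ-vanishing-tail g c B c≤B vanish ⟨
  Σ g B                              ≡⟨ Σ-cong B indicators ⟩
  Σ (λ k → coprimeWeight q k ℚ.* ι (does (k ∣? N))) B ∎
  where
  open ≡-Reasoning
  open IsCoprimePart (coprimePart-spec q N 1≤N)
  c = coprimePart q N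
  g : ℕ → ℚ
  g k = if does (k ∣? c) then φ/ord q k else 0ℚ
  c≤B : c ≤ B
  c≤B = ℕP.≤-trans (∣⇒≤ {{ℕ.>-nonZero 1≤N}} c∣N) N≤B
  vanish : ∀ k → c < k → g k ≡ 0ℚ
  vanish k c<k = if-false (dec-false (k ∣? c) (λ k∣c → ℕP.<⇒≱ c<k (∣⇒≤ {{ℕ.>-nonZero positive}} k∣c)))
  indicators : ∀ k → g k ≡ coprimeWeight q k ℚ.* ι (does (k ∣? N))
  indicators k = if-∧ (φ/ord q k) (does (k ∣? c)) (does (k ∣? N)) (does (gcd k q ℕP.≟ 1))
    (does-⇔ (mk⇔ (proj₁ (∣coprimePart⇔ q N k 1≤N)) (λ (k∣N , k⊥q) → proj₂ (∣coprimePart⇔ q N k 1≤N) k∣N k⊥q))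
            (k ∣? c) ((k ∣? N) ×-dec (gcd k q ℕP.≟ 1)))

D-term : ℕ → ℕ → ℕ → ℕ → ℚ
D-term q n r d = μℚ d ℚ.* (sumℚ (map (φ/ord q) (divisors (coprimePart q (n ^ (r / suc (d ∸ 1)) ∸ 1)))) ℚ.+ 1ℚ)

D-Σ-divisors : ∀ q n r → D q n r ≡ Σ-divisors r (D-term q n r)
D-Σ-divisors q n r = trans (sumℚ-filter (_∣? r) (D-term q n r) (oneTo r)) (sumℚ-oneTo _ r)

expand-divisor-term : ∀ (b : Bool) (m S : ℚ) (a u : ℕ → ℚ) B → S ≡ Σ (λ k → a k ℚ.* u k) B →
  (if b then m ℚ.* (S ℚ.+ 1ℚ) else 0ℚ) ≡ Σ (λ k → a k ℚ.* (if b then m ℚ.* u k else 0ℚ)) B ℚ.+ (if b then m else 0ℚ)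
expand-divisor-term false m S a u B _ =
  sym (trans (ℚP.+-identityʳ _) (trans (Σ-cong B (λ k → ℚP.*-zeroʳ (a k))) (Σ-zero B)))
expand-divisor-term true m S a u B S≡ = begin
  m ℚ.* (S ℚ.+ 1ℚ)                      ≡⟨ ℚP.*-distribˡ-+ m S 1ℚ ⟩
  m ℚ.* S ℚ.+ m ℚ.* 1ℚ                  ≡⟨ cong₂ ℚ._+_ (trans (cong (m ℚ.*_) S≡) (Σ-*ˡ m _ B)) (ℚP.*-identityʳ m) ⟩
  Σ (λ k → m ℚ.* (a k ℚ.* u k)) B ℚ.+ m ≡⟨ cong (ℚ._+ m) (Σ-cong B (λ k → exchange m (a k) (u k))) ⟩
  Σ (λ k → a k ℚ.* (m ℚ.* u k)) B ℚ.+ m ∎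
  where
  open ≡-Reasoning
  exchange : ∀ x y z → x ℚ.* (y ℚ.* z) ≡ y ℚ.* (x ℚ.* z)
  exchange x y z = trans (sym (ℚP.*-assoc x y z)) (trans (cong (ℚ._* z) (ℚP.*-comm x y)) (ℚP.*-assoc y x z))

pow≥base : ∀ n m → 1 ≤ m → .{{_ : NonZero n}} → n ≤ n ^ m
pow≥base n (suc m) _ = ℕP.m≤m*n n (n ^ m) {{ℕP.m^n≢0 n m}}

D-decomposition : ∀ q n r → 2 ≤ n → D q n r ≡ Σ (λ k → coprimeWeight q k ℚ.* W k n r) (n ^ r) ℚ.+ μ-sum r
D-decomposition q n r 2≤n = begin
  D q n r                                  ≡⟨ D-Σ-divisors q n r ⟩
  Σ-divisors r (D-term q n r)              ≡⟨ Σ-cong-on r expand ⟩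
  Σ (λ d → X d ℚ.+ Y d) r                  ≡⟨ Σ-+ X Y r ⟩
  Σ X r ℚ.+ μ-sum r                        ≡⟨ cong (ℚ._+ μ-sum r) (Σ-swap F r B) ⟩
  Σ (λ k → Σ (λ d → F d k) r) B ℚ.+ μ-sum r ≡⟨ cong (ℚ._+ μ-sum r) (Σ-cong B (λ k → sym (Σ-*ˡ (coprimeWeight q k) _ r))) ⟩
  Σ (λ k → coprimeWeight q k ℚ.* W k n r) B ℚ.+ μ-sum r ∎
  where
  open ≡-Reasoning
  instance _ = ℕ.>-nonZero (ℕP.<-trans (s≤s z≤n) 2≤n)
  B = n ^ r
  F : ℕ → ℕ → ℚ
  F d k = coprimeWeight q k ℚ.* (if does (d ∣? r) then W-term k n r d else 0ℚ)
  X Y : ℕ → ℚ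
  X d = Σ (F d) B
  Y d = if does (d ∣? r) then μℚ d else 0ℚ
  expand : ∀ d → 1 ≤ d → d ≤ r → (if does (d ∣? r) then D-term q n r d else 0ℚ) ≡ X d ℚ.+ Y d
  expand d@(suc d′) _ d≤r = expand-divisor-term (does (d ∣? r)) (μℚ d) _ (coprimeWeight q)
    (λ k → ι (does (k ∣? (n ^ e ∸ 1)))) B (coprimePart-sum q (n ^ e ∸ 1) B 1≤N N≤B)
    where
    e = r / d
    1≤e : 1 ≤ e
    1≤e = m≥n⇒m/n>0 d≤r
    1≤N : 1 ≤ n ^ e ∸ 1
    1≤N = ℕP.∸-monoˡ-≤ 1 (ℕP.≤-trans 2≤n (pow≥base n e 1≤e))
    N≤B : n ^ e ∸ 1 ≤ B
    N≤B = ℕP.≤-trans (ℕP.m∸n≤m (n ^ e) 1) (ℕP.^-monoʳ-≤ n (m/n≤m r d))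

module _ (q n r : ℕ) (2≤n : 2 ≤ n) (1≤r : 1 ≤ r) where

  private instance _ = ℕ.>-nonZero (ℕP.<-trans (s≤s z≤n) 2≤n)

  summand : ℕ → ℚ
  summand k = coprimeWeight q k ℚ.* W k n r

  summand-nonneg : ∀ k → 1 ≤ k → k ≤ n ^ r → 0ℚ ℚ.≤ summand k
  summand-nonneg k _ _ = *-nonneg _ _ (coprimeWeight-nonneg q k) (W-nonneg k n r 1≤r)

  Σ-summand≤D : Σ summand (n ^ r) ℚ.≤ D q n r
  Σ-summand≤D = begin
    Σ summand (n ^ r)               ≡⟨ ℚP.+-identityʳ _ ⟨
    Σ summand (n ^ r) ℚ.+ 0ℚ        ≤⟨ ℚP.+-monoʳ-≤ (Σ summand (n ^ r)) (μ-sum-nonneg r 1≤r) ⟩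
    Σ summand (n ^ r) ℚ.+ μ-sum r   ≡⟨ D-decomposition q n r 2≤n ⟨
    D q n r                         ∎
    where open ℚP.≤-Reasoning

  D-nonneg : 0ℚ ℚ.≤ D q n r
  D-nonneg = ℚP.≤-trans (Σ-nonneg summand (n ^ r) summand-nonneg) Σ-summand≤D

  D-≥-φ/ord : ∀ k → 1 ≤ k → k ≤ n ^ r → gcd k q ≡ 1 → Least (PowIsOne k n) r → φ/ord q k ℚ.≤ D q n r
  D-≥-φ/ord k 1≤k k≤B k⊥q order-r = begin
    φ/ord q k             ≡⟨ summand-k ⟨
    summand k             ≤⟨ term≤Σ summand (n ^ r) k summand-nonneg 1≤k k≤B ⟩
    Σ summand (n ^ r)     ≤⟨ Σ-summand≤D ⟩
    D q n r               ∎
    where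
    open ℚP.≤-Reasoning
    summand-k : summand k ≡ φ/ord q k
    summand-k = trans (cong₂ ℚ._*_
      (trans (cong (λ b → φ/ord q k ℚ.* ι b) (dec-true (gcd k q ℕP.≟ 1) k⊥q)) (ℚP.*-identityʳ (φ/ord q k)))
      (W-exact-order k n r order-r)) (ℚP.*-identityʳ (φ/ord q k))

-- l_k ≤ φ(k): the residues q, q², …, q^(l_k) are distinct units modulo k.

count-mono : ∀ (b : ℕ → Bool) {m n} → m ≤ n → count b m ≤ count b n
count-mono b {m} {n} m≤n = subst (λ z → count b m ≤ count b z) (ℕP.m∸n+n≡m m≤n) (go (n ∸ m))
  where
  go : ∀ d → count b m ≤ count b (d + m)
  go zero    = ℕP.≤-refl
  go (suc d) = ℕP.≤-trans (go d) (ℕP.m≤m+n _ _)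

rank : (ℕ → Bool) → ℕ → ℕ
rank b x = count b (x ∸ 1)

rank<count : ∀ b K x → 1 ≤ x → x ≤ K → b x ≡ true → rank b x < count b K
rank<count b K (suc x) _ x≤K bx = ℕP.≤-trans (ℕP.≤-reflexive (sym step)) (count-mono b x≤K)
  where
  step : count b (suc x) ≡ suc (count b x)
  step rewrite bx = ℕP.+-comm (count b x) 1

rank-mono : ∀ b x y → 1 ≤ x → x < y → b x ≡ true → rank b x < rank b y
rank-mono b (suc x) (suc y) _ (s≤s x<y) bx = rank<count b y (suc x) (s≤s z≤n) x<y bx

injection⇒≤count : ∀ (b : ℕ → Bool) K L (f : ℕ → ℕ) →
  (∀ i → 1 ≤ i → i ≤ L → 1 ≤ f i × f i ≤ K × b (f i) ≡ true) →
  (∀ i j → 1 ≤ i → i < j → j ≤ L → f i ≢ f j) → L ≤ count b K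
injection⇒≤count b K L f maps injective with L ℕP.≤? count b K
... | yes L≤ = L≤
... | no L≰ with FinP.pigeonhole (ℕP.≰⇒> L≰) (λ i → fromℕ< (rank-f i))
  where
  rank-f : (i : Fin L) → rank b (f (suc (toℕ i))) < count b K
  rank-f i = let (1≤ , ≤K , bf) = maps (suc (toℕ i)) (s≤s z≤n) (FinP.toℕ<n i) in rank<count b K _ 1≤ ≤K bf
... | i , j , i<j , same-rank = ⊥-elim (injective (suc (toℕ i)) (suc (toℕ j)) (s≤s z≤n) (s≤s i<j) (FinP.toℕ<n j) fi≡fj)
  where
  x = f (suc (toℕ i))
  y = f (suc (toℕ j))
  image : ∀ (i : Fin L) → 1 ≤ f (suc (toℕ i)) × f (suc (toℕ i)) ≤ K × b (f (suc (toℕ i))) ≡ true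
  image i = maps (suc (toℕ i)) (s≤s z≤n) (FinP.toℕ<n i)
  rx≡ry : rank b x ≡ rank b y
  rx≡ry = trans (sym (FinP.toℕ-fromℕ< _)) (trans (cong toℕ same-rank) (FinP.toℕ-fromℕ< _))
  fi≡fj : x ≡ y
  fi≡fj with ℕP.<-cmp x y
  ... | tri≈ _ x≡y _ = x≡y
  ... | tri< x<y _ _ = ⊥-elim (ℕP.<-irrefl rx≡ry (rank-mono b x y (proj₁ (image i)) x<y (proj₂ (proj₂ (image i)))))
  ... | tri> _ _ y<x = ⊥-elim (ℕP.<-irrefl (sym rx≡ry) (rank-mono b y x (proj₁ (image j)) y<x (proj₂ (proj₂ (image j)))))

%-equal⇒∣∸ : ∀ k a b .{{_ : NonZero k}} → a % k ≡ b % k → a ≤ b → k ∣ b ∸ a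
%-equal⇒∣∸ k a b a≡b a≤b = divides (b / k ∸ a / k) (begin
  b ∸ a                                      ≡⟨ cong₂ _∸_ (m≡m%n+[m/n]*n b k) (m≡m%n+[m/n]*n a k) ⟩
  (b % k + b / k * k) ∸ (a % k + a / k * k) ≡⟨ cong (λ z → (b % k + b / k * k) ∸ (z + a / k * k)) a≡b ⟩
  (b % k + b / k * k) ∸ (b % k + a / k * k) ≡⟨ ℕP.[m+n]∸[m+o]≡n∸o (b % k) _ _ ⟩
  b / k * k ∸ a / k * k                      ≡⟨ ℕP.*-distribʳ-∸ k (b / k) (a / k) ⟨
  (b / k ∸ a / k) * k                        ∎)
  where open ≡-Reasoning

module _ (q k′ : ℕ) where

  private
    k = suc k′

  ordSearch-below : ∀ fuel l → l ≤ ordSearch q k fuel l ×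
    (∀ j → l ≤ j → j < ordSearch q k fuel l → (q ^ suc j) % k ≢ 1 % k)
  ordSearch-below zero l = ℕP.≤-refl , λ j l≤j j<l _ → ℕP.<⇒≱ j<l l≤j
  ordSearch-below (suc fuel) l with ((q ^ suc l) % k) ≡ᵇ (1 % k) in test
  ... | true  = ℕP.≤-refl , λ j l≤j j<l _ → ℕP.<⇒≱ j<l l≤j
  ... | false = ℕP.≤-trans (ℕP.n≤1+n l) (proj₁ next) , below
    where
    next = ordSearch-below fuel (suc l)
    below : ∀ j → l ≤ j → j < ordSearch q k fuel (suc l) → (q ^ suc j) % k ≢ 1 % k
    below j l≤j j< e with ℕP.m≤n⇒m<n∨m≡n l≤j
    ... | inj₁ l<j  = proj₂ next j l<j j< e
    ... | inj₂ refl = subst T test (ℕP.≡⇒≡ᵇ _ _ e)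

  ord-minimal : ∀ t → 1 ≤ t → t < ord q k → (q ^ t) % k ≢ 1 % k
  ord-minimal (suc t) _ (s≤s t<) = proj₂ (ordSearch-below k 0) t z≤n t<

  gcd-pow : gcd q k ≡ 1 → ∀ i → gcd (q ^ i) k ≡ 1
  gcd-pow q⊥k zero    = gcd-zeroˡ k
  gcd-pow q⊥k (suc i) = gcd≡1-* {q} {q ^ i} q⊥k (gcd-pow q⊥k i)

  gcd-% : ∀ a → gcd a k ≡ 1 → gcd (a % k) k ≡ 1
  gcd-% a a⊥k = ∣1⇒≡1 (subst (gcd (a % k) k ∣_) a⊥k (gcd-greatest
    (∣n∣m%n⇒∣m {m = a} (gcd[m,n]∣n (a % k) k) (gcd[m,n]∣m (a % k) k)) (gcd[m,n]∣n (a % k) k)))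

  %-positive : ∀ a → gcd a k ≡ 1 → 2 ≤ k → 1 ≤ a % k
  %-positive a a⊥k 2≤k with a % k in e
  ... | suc _ = s≤s z≤n
  ... | zero  = ⊥-elim (ℕP.<-irrefl (sym (∣1⇒≡1 (subst (k ∣_) a⊥k (gcd-greatest (m%n≡0⇒n∣m a k e) ∣-refl)))) 2≤k)

  -- q^i ≡ q^j (mod k) with i < j forces q^(j-i) ≡ 1 (mod k), since q is a unit.
  cancel-power : 1 ≤ q → gcd q k ≡ 1 → ∀ i j → i < j → (q ^ i) % k ≡ (q ^ j) % k → (q ^ (j ∸ i)) % k ≡ 1 % k
  cancel-power 1≤q q⊥k i j i<j e = k∣-1⇒≡1 (coprime-divisor k⊥qⁱ (subst (k ∣_) (pow-diff i t) k∣diff))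
    where
    instance _ = ℕ.>-nonZero 1≤q
    t = j ∸ i
    k⊥qⁱ : Coprime k (q ^ i)
    k⊥qⁱ = gcd≡1⇒coprime (trans (gcd-comm k (q ^ i)) (gcd-pow q⊥k i))
    pow-diff : ∀ i t → q ^ (i + t) ∸ q ^ i ≡ q ^ i * (q ^ t ∸ 1)
    pow-diff i t = trans (cong (_∸ q ^ i) (ℕP.^-distribˡ-+-* q i t))
      (trans (cong (q ^ i * q ^ t ∸_) (sym (ℕP.*-identityʳ (q ^ i)))) (sym (ℕP.*-distribˡ-∸ (q ^ i) (q ^ t) 1)))
    k∣diff : k ∣ q ^ (i + t) ∸ q ^ i
    k∣diff = subst (λ z → k ∣ q ^ z ∸ q ^ i) (sym (ℕP.m+[n∸m]≡n (ℕP.<⇒≤ i<j)))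
      (%-equal⇒∣∸ k (q ^ i) (q ^ j) e (ℕP.^-monoʳ-≤ q (ℕP.<⇒≤ i<j)))
    k∣-1⇒≡1 : k ∣ q ^ t ∸ 1 → (q ^ t) % k ≡ 1 % k
    k∣-1⇒≡1 (divides c qᵗ-1≡) = trans (cong (_% k) qᵗ≡) ([m+kn]%n≡m%n 1 c k)
      where
      qᵗ≡ : q ^ t ≡ 1 + c * k
      qᵗ≡ = trans (sym (ℕP.m∸n+n≡m {q ^ t} {1} (ℕP.m^n>0 q t))) (trans (cong (_+ 1) qᵗ-1≡) (ℕP.+-comm (c * k) 1))

  ord≤φ : 1 ≤ q → gcd q k ≡ 1 → 2 ≤ k → ord q k ≤ φ k
  ord≤φ 1≤q q⊥k 2≤k = subst (ord q k ≤_) (sym (length-filter-oneTo (λ i → gcd i k ℕP.≟ 1) k))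
    (injection⇒≤count (λ i → does (gcd i k ℕP.≟ 1)) k (ord q k) (λ i → (q ^ i) % k) maps injective)
    where
    maps : ∀ i → 1 ≤ i → i ≤ ord q k → 1 ≤ (q ^ i) % k × (q ^ i) % k ≤ k × does (gcd ((q ^ i) % k) k ℕP.≟ 1) ≡ true
    maps i _ _ = %-positive (q ^ i) (gcd-pow q⊥k i) 2≤k , ℕP.<⇒≤ (m%n<n (q ^ i) k) ,
      dec-true (gcd ((q ^ i) % k) k ℕP.≟ 1) (gcd-% (q ^ i) (gcd-pow q⊥k i))
    injective : ∀ i j → 1 ≤ i → i < j → j ≤ ord q k → (q ^ i) % k ≢ (q ^ j) % k
    injective i j 1≤i i<j j≤ord e =
      ord-minimal (j ∸ i) (ℕP.m<n⇒0<n∸m i<j) (ℕP.<-≤-trans (ℕP.∸-monoʳ-< {j} {i} {0} 1≤i (ℕP.<⇒≤ i<j)) j≤ord)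
        (cancel-power 1≤q q⊥k i j i<j e)

repunit : ℕ → ℕ → ℕ
repunit n zero    = 0
repunit n (suc r) = 1 + n * repunit n r

repunit-geometric : ∀ m r → repunit (suc m) r * m + 1 ≡ suc m ^ r
repunit-geometric m zero    = refl
repunit-geometric m (suc r) = trans (identity (repunit (suc m) r) m) (cong (suc m *_) (repunit-geometric m r))
  where
  identity : ∀ s m → (1 + suc m * s) * m + 1 ≡ suc m * (s * m + 1)
  identity = solve-∀

repunit-+ : ∀ n a b → repunit n (a + b) ≡ repunit n a + n ^ a * repunit n b
repunit-+ n zero    b = sym (ℕP.+-identityʳ (repunit n b))
repunit-+ n (suc a) b = trans (cong (λ z → 1 + n * z) (repunit-+ n a b)) (identity (repunit n a) (n ^ a) (repunit n b) n)
  where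
  identity : ∀ x y z n → 1 + n * (x + y * z) ≡ 1 + n * x + n * y * z
  identity = solve-∀

module _ (m : ℕ) (1≤m : 1 ≤ m) where

  private
    n = suc m

  repunit-PowIsOne : ∀ r → PowIsOne (repunit n r) n r
  repunit-PowIsOne r = divides m (trans (cong (_∸ 1) (sym (repunit-geometric m r)))
    (trans (ℕP.m+n∸n≡m (repunit n r * m) 1) (ℕP.*-comm (repunit n r) m)))

  repunit-positive : ∀ r → 1 ≤ r → 1 ≤ repunit n r
  repunit-positive (suc r) _ = s≤s z≤n

  repunit≤pow : ∀ r → repunit n r ≤ n ^ r
  repunit≤pow r = ℕP.≤-trans (ℕP.≤-trans (ℕP.m≤m*n (repunit n r) m {{ℕ.>-nonZero 1≤m}}) (ℕP.m≤m+n _ 1))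
    (ℕP.≤-reflexive (repunit-geometric m r))

  pow<repunit : ∀ r → n ^ suc r < repunit n (suc (suc r))
  pow<repunit r = s≤s (ℕP.*-monoʳ-≤ n (pow≤repunit r))
    where
    pow≤repunit : ∀ r → n ^ r ≤ repunit n (suc r)
    pow≤repunit zero    = s≤s z≤n
    pow≤repunit (suc r) = ℕP.≤-trans (ℕP.*-monoʳ-≤ n (pow≤repunit r)) (ℕP.n≤1+n _)

  repunit-≥2 : ∀ r → 2 ≤ r → 2 ≤ repunit n r
  repunit-≥2 (suc zero)    (s≤s ())
  repunit-≥2 (suc (suc r)) _ = ℕP.<-≤-trans (s≤s (ℕP.m^n>0 n (suc r))) (pow<repunit r)

  -- For r ≥ 2 and 1 ≤ t < r, 0 < n^t - 1 < S_r, so S_r ∤ n^t - 1.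
  repunit-order : ∀ r → 2 ≤ r → Least (PowIsOne (repunit n r) n) r
  repunit-order (suc zero)         (s≤s ())
  repunit-order r@(suc (suc r′)) _ = s≤s z≤n , repunit-PowIsOne r , below
    where
    below : ∀ t → 1 ≤ t → t < r → ¬ PowIsOne (repunit n r) n t
    below t 1≤t t<r S∣ = ℕP.<⇒≱ (ℕP.≤-<-trans (ℕP.m∸n≤m (n ^ t) 1)
      (ℕP.≤-<-trans (ℕP.^-monoʳ-≤ n (ℕ.s≤s⁻¹ t<r)) (pow<repunit r′))) (∣⇒≤ {{ℕ.>-nonZero 0<nᵗ-1}} S∣)
      where
      0<nᵗ-1 : 1 ≤ n ^ t ∸ 1
      0<nᵗ-1 = ℕP.∸-monoˡ-≤ 1 (ℕP.≤-trans (s≤s 1≤m) (pow≥base n t 1≤t))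

¬∣-pow : ∀ {p n} → Prime p → ¬ p ∣ n → ∀ i → ¬ p ∣ n ^ i
¬∣-pow pp ¬p∣n zero    p∣1 = ℕP.<-irrefl (sym (∣1⇒≡1 p∣1)) (prime≥2 pp)
¬∣-pow {p} {n} pp ¬p∣n (suc i) p∣nⁱ⁺¹ with euclidsLemma n (n ^ i) pp p∣nⁱ⁺¹
... | inj₁ p∣n  = ¬p∣n p∣n
... | inj₂ p∣nⁱ = ¬∣-pow pp ¬p∣n i p∣nⁱ

gcd-prime-pow : ∀ {p x} → Prime p → ¬ p ∣ x → ∀ e → gcd x (p ^ e) ≡ 1
gcd-prime-pow {p} {x} pp ¬p∣x e = trans (gcd-comm x (p ^ e)) (go e)
  where
  go : ∀ e → gcd (p ^ e) x ≡ 1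
  go zero    = gcd-zeroˡ x
  go (suc e) = gcd≡1-* {p} {p ^ e} (trans (gcd-comm p x) (coprime⇒gcd≡1 (coprime-prime pp ¬p∣x))) (go e)

-- If p ∣ S_t then S_{1 + j t} ≡ S_1 = 1 (mod p) for every j.
repunit-shift : ∀ {p} n t → Prime p → p ∣ repunit n t → ∀ j → ¬ p ∣ repunit n (1 + j * t)
repunit-shift {p} n t pp p∣Sₜ zero p∣S₁ =
  ℕP.<-irrefl (sym (∣1⇒≡1 (subst (p ∣_) (cong suc (ℕP.*-zeroʳ n)) p∣S₁))) (prime≥2 pp)
repunit-shift {p} n t pp p∣Sₜ (suc j) p∣S = repunit-shift n t pp p∣Sₜ j p∣Sₐ
  where
  a = 1 + j * t
  p∣Sₐ+ : p ∣ repunit n a + n ^ a * repunit n t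
  p∣Sₐ+ = subst (p ∣_) (trans (cong (repunit n) (identity j t)) (repunit-+ n a t)) p∣S
    where
    identity : ∀ j t → 1 + (t + j * t) ≡ (1 + j * t) + t
    identity = solve-∀
  p∣Sₐ : p ∣ repunit n a
  p∣Sₐ = ∣m+n∣m⇒∣n (subst (p ∣_) (ℕP.+-comm (repunit n a) _) p∣Sₐ+) (∣-trans p∣Sₜ (n∣m*n (n ^ a)))

-- If p ∣ n take P = 1 (S_r ≡ 1); otherwise two of S_0, …, S_p agree mod p,
-- and S_b - S_a = n^a S_(b-a) gives p ∣ S_(b-a).
repunit-period : ∀ {p} n → Prime p → ∃ λ P → 1 ≤ P × (∀ j → ¬ p ∣ repunit n (1 + j * P))
repunit-period {p} n pp with p ∣? n
... | yes p∣n = 1 , ℕP.≤-refl , λ j p∣S → ℕP.<-irrefl (sym (∣1⇒≡1 (∣m+n∣m⇒∣n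
  (subst (p ∣_) (ℕP.+-comm 1 _) p∣S) (∣-trans p∣n (m∣m*n (repunit n (j * 1))))))) (prime≥2 pp)
... | no ¬p∣n with FinP.pigeonhole (ℕP.n<1+n p) residue
  where
  instance _ = prime⇒nonZero pp
  residue : Fin (suc p) → Fin p
  residue i = fromℕ< (m%n<n (repunit n (toℕ i)) p)
... | i , j , i<j , same = toℕ j ∸ toℕ i , ℕP.m<n⇒0<n∸m i<j , repunit-shift n t pp p∣Sₜ
  where
  instance _ = prime⇒nonZero pp
  a = toℕ i
  t = toℕ j ∸ a
  Sⱼ≡ : repunit n (toℕ j) ≡ repunit n a + n ^ a * repunit n t
  Sⱼ≡ = trans (cong (repunit n) (sym (ℕP.m+[n∸m]≡n (ℕP.<⇒≤ i<j)))) (repunit-+ n a t)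
  p∣nᵃSₜ : p ∣ n ^ a * repunit n t
  p∣nᵃSₜ = subst (p ∣_) (trans (cong (_∸ repunit n a) Sⱼ≡) (ℕP.m+n∸m≡n (repunit n a) _))
    (%-equal⇒∣∸ p (repunit n a) (repunit n (toℕ j))
      (trans (sym (FinP.toℕ-fromℕ< _)) (trans (cong toℕ same) (FinP.toℕ-fromℕ< _)))
      (subst (repunit n a ≤_) (sym Sⱼ≡) (ℕP.m≤m+n _ _)))
  p∣Sₜ : p ∣ repunit n t
  p∣Sₜ with euclidsLemma (n ^ a) (repunit n t) pp p∣nᵃSₜ
  ... | inj₁ p∣nᵃ = ⊥-elim (¬∣-pow pp ¬p∣n a p∣nᵃ)
  ... | inj₂ p∣Sₜ = p∣Sₜ

/-mono : ∀ a b c d .{{_ : NonZero b}} .{{_ : NonZero d}} → a * d ≤ c * b → (+ a) ℚ./ b ℚ.≤ (+ c) ℚ./ d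
/-mono a b@(suc b′) c d@(suc d′) ad≤cb = ℚP.toℚᵘ-cancel-≤
  (ℚᵘP.≤-respˡ-≃ (ℚᵘP.≃-sym (ℚP.toℚᵘ-fromℚᵘ (mkℚᵘ (+ a) b′)))
  (ℚᵘP.≤-respʳ-≃ (ℚᵘP.≃-sym (ℚP.toℚᵘ-fromℚᵘ (mkℚᵘ (+ c) d′)))
  (*≤* (subst₂ ℤ._≤_ (ℤP.pos-* a d) (ℤP.pos-* c b) (ℤ.+≤+ ad≤cb)))))

reciprocal-≤ : ∀ a b .{{_ : NonZero a}} .{{_ : NonZero b}} → a ≤ b → (+ 1) ℚ./ b ℚ.≤ (+ 1) ℚ./ a
reciprocal-≤ a b a≤b = /-mono 1 b 1 a (subst₂ _≤_ (sym (ℕP.*-identityˡ a)) (sym (ℕP.*-identityˡ b)) a≤b)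

/-+ : ∀ a c b .{{_ : NonZero b}} → (+ a) ℚ./ b ℚ.+ (+ c) ℚ./ b ≡ (+ (a + c)) ℚ./ b
/-+ a c b@(suc b′) = ℚP.toℚᵘ-injective (ℚᵘP.≃-trans (ℚP.toℚᵘ-homo-+ ((+ a) ℚ./ b) ((+ c) ℚ./ b))
  (ℚᵘP.≃-trans (ℚᵘP.+-cong (ℚP.toℚᵘ-fromℚᵘ (mkℚᵘ (+ a) b′)) (ℚP.toℚᵘ-fromℚᵘ (mkℚᵘ (+ c) b′)))
  (ℚᵘP.≃-trans (*≡* cross) (ℚᵘP.≃-sym (ℚP.toℚᵘ-fromℚᵘ (mkℚᵘ (+ (a + c)) b′))))))
  where
  identity : ∀ a c b → (a * b + c * b) * b ≡ (a + c) * (b * b)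
  identity = solve-∀
  cross : (+ a ℤ.* + b ℤ.+ + c ℤ.* + b) ℤ.* + b ≡ + (a + c) ℤ.* (+ (b * b))
  cross = trans (cong₂ (λ u v → (u ℤ.+ v) ℤ.* + b) (sym (ℤP.pos-* a b)) (sym (ℤP.pos-* c b)))
    (trans (sym (ℤP.pos-* (a * b + c * b) b)) (trans (cong +_ (identity a c b)) (ℤP.pos-* (a + c) (b * b))))

/-nonneg : ∀ a b .{{_ : NonZero b}} → 0ℚ ℚ.≤ (+ a) ℚ./ b
/-nonneg a b = ℚP.nonNegative⁻¹ _ {{ℚP.normalize-nonNeg a b}}

≤-numerator : ∀ (x : ℚ) → x ℚ.≤ (+ ℤ.∣ ℚ.↥ x ∣) ℚ./ 1
≤-numerator (mkℚ (+ a) d _) = ℚP.toℚᵘ-cancel-≤ (ℚᵘP.≤-respʳ-≃ (ℚᵘP.≃-sym (ℚP.toℚᵘ-fromℚᵘ (mkℚᵘ (+ a) 0)))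
  (*≤* (subst₂ ℤ._≤_ (ℤP.pos-* a 1) (ℤP.pos-* a (suc d)) (ℤ.+≤+ (ℕP.*-monoʳ-≤ a (s≤s z≤n))))))
≤-numerator (mkℚ ℤ.-[1+ a ] d _) =
  ℚP.toℚᵘ-cancel-≤ (ℚᵘP.≤-respʳ-≃ (ℚᵘP.≃-sym (ℚP.toℚᵘ-fromℚᵘ (mkℚᵘ (+ suc a) 0))) (*≤* ℤ.-≤+))

Σ-constant : ∀ b .{{_ : NonZero b}} K → Σ (λ _ → (+ 1) ℚ./ b) K ≡ (+ K) ℚ./ b
Σ-constant b zero    = ℚP.≤-antisym (/-mono 0 1 0 b z≤n) (/-mono 0 b 0 1 z≤n)
Σ-constant b (suc K) = trans (cong (ℚ._+ (+ 1) ℚ./ b) (Σ-constant b K))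
  (trans (/-+ K 1 b) (cong (λ z → (+ z) ℚ./ b) (ℕP.+-comm K 1)))

H : ℕ → ℕ → ℚ
H P = Σ (λ j → (+ 1) ℚ./ suc (j * P))

H-nonneg : ∀ P T → 0ℚ ℚ.≤ H P T
H-nonneg P T = Σ-nonneg _ T (λ j _ _ → /-nonneg 1 (suc (j * P)))

-- Doubling the range adds at least 1/(2P+1): each of the K new terms is ≥ 1/(K(2P+1)).
H-doubling : ∀ P K → 1 ≤ K → H P K ℚ.+ (+ 1) ℚ./ suc (P + P) ℚ.≤ H P (K + K)
H-doubling P K@(suc K′) _ = begin
  H P K ℚ.+ (+ 1) ℚ./ c                             ≤⟨ ℚP.+-monoʳ-≤ (H P K) block ⟩
  H P K ℚ.+ Σ (λ i → (+ 1) ℚ./ suc ((i + K) * P)) K ≡⟨ Σ-split _ K K ⟨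
  H P (K + K)                                       ∎
  where
  open ℚP.≤-Reasoning
  c = suc (P + P)
  instance _ = ℕP.m*n≢0 K c
  denominator≤ : ∀ i → i ≤ K → suc ((i + K) * P) ≤ K * c
  denominator≤ i i≤K = ℕP.≤-trans (s≤s (ℕP.*-monoˡ-≤ P (ℕP.+-monoˡ-≤ K i≤K)))
    (ℕP.≤-trans (s≤s (ℕP.≤-trans (ℕP.≤-reflexive (identity₁ K P)) (ℕP.m≤n+m _ K′))) (ℕP.≤-reflexive (sym (identity₂ K′ P))))
    where
    identity₁ : ∀ K P → (K + K) * P ≡ K * (P + P)
    identity₁ = solve-∀
    identity₂ : ∀ K′ P → suc K′ * suc (P + P) ≡ suc (K′ + suc K′ * (P + P))
    identity₂ = solve-∀
  block : (+ 1) ℚ./ c ℚ.≤ Σ (λ i → (+ 1) ℚ./ suc ((i + K) * P)) K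
  block = begin
    (+ 1) ℚ./ c                                  ≤⟨ /-mono 1 c K (K * c) (ℕP.≤-reflexive (ℕP.*-identityˡ (K * c))) ⟩
    (+ K) ℚ./ (K * c)                            ≡⟨ Σ-constant (K * c) K ⟨
    Σ (λ _ → (+ 1) ℚ./ (K * c)) K                ≤⟨ Σ-mono _ _ K (λ i _ i≤K → reciprocal-≤ _ (K * c) (denominator≤ i i≤K)) ⟩
    Σ (λ i → (+ 1) ℚ./ suc ((i + K) * P)) K      ∎

H-divergent : ∀ P t → (+ t) ℚ./ suc (P + P) ℚ.≤ H P (2 ^ t)
H-divergent P zero    = ℚP.≤-trans (/-mono 0 (suc (P + P)) 0 1 z≤n) (H-nonneg P 1)
H-divergent P (suc t) = begin
  (+ suc t) ℚ./ c                    ≡⟨ trans (cong (λ z → (+ z) ℚ./ c) (ℕP.+-comm 1 t)) (sym (/-+ t 1 c)) ⟩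
  (+ t) ℚ./ c ℚ.+ (+ 1) ℚ./ c        ≤⟨ ℚP.+-monoˡ-≤ ((+ 1) ℚ./ c) (H-divergent P t) ⟩
  H P (2 ^ t) ℚ.+ (+ 1) ℚ./ c        ≤⟨ H-doubling P (2 ^ t) (ℕP.m^n>0 2 t) ⟩
  H P (2 ^ t + 2 ^ t)                ≡⟨ cong (λ z → H P (2 ^ t + z)) (sym (ℕP.+-identityʳ (2 ^ t))) ⟩
  H P (2 ^ suc t)                    ∎
  where
  open ℚP.≤-Reasoning
  c = suc (P + P)

Σ-progression≤ : ∀ (f g : ℕ → ℚ) P → 1 ≤ P → (∀ i → 1 ≤ i → 0ℚ ℚ.≤ f i) →
  (∀ j → 1 ≤ j → g j ℚ.≤ f (suc (j * P))) → ∀ T → Σ g T ℚ.≤ Σ f (suc (T * P))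
Σ-progression≤ f g P 1≤P f≥0 g≤f zero = Σ-nonneg f 1 (λ i 1≤i _ → f≥0 i 1≤i)
Σ-progression≤ f g P 1≤P f≥0 g≤f (suc T) = begin
  Σ g T ℚ.+ g (suc T)                              ≤⟨ ℚP.+-mono-≤ (Σ-progression≤ f g P 1≤P f≥0 g≤f T) last-term ⟩
  Σ f a ℚ.+ Σ (λ i → f (i + a)) P                  ≡⟨ Σ-split f a P ⟨
  Σ f (P + a)                                      ≡⟨ cong (Σ f) (ℕP.+-suc P (T * P)) ⟩
  Σ f (suc (suc T * P))                            ∎
  where
  open ℚP.≤-Reasoning
  a = suc (T * P)
  last-term : g (suc T) ℚ.≤ Σ (λ i → f (i + a)) P
  last-term = ℚP.≤-trans (g≤f (suc T) (s≤s z≤n))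
    (ℚP.≤-trans (ℚP.≤-reflexive (cong f (sym (ℕP.+-suc P (T * P)))))
      (term≤Σ (λ i → f (i + a)) P P (λ i 1≤i _ → f≥0 (i + a) (ℕP.≤-trans 1≤i (ℕP.m≤m+n i a))) 1≤P ℕP.≤-refl))

-- The cycle bound: if q is a power of the prime p, n ≥ 2, r ≥ 2 and p ∤ S_r,
-- then C(r) ≥ 1/r.  Take k = S_r: it is prime to q, n has order r modulo k,
-- and l_k ≤ φ(k), so D(r) ≥ φ(k)/l_k ≥ 1.
C-≥-reciprocal : ∀ {p} q m e → Prime p → q ≡ p ^ e → 1 ≤ m → ∀ r′ → 1 ≤ r′ →
  ¬ p ∣ repunit (suc m) (suc r′) → (+ 1) ℚ./ suc r′ ℚ.≤ C q (suc m) (suc r′)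
C-≥-reciprocal {p} q m e pp q≡pᵉ 1≤m r′ 1≤r′ ¬p∣k = begin
  (+ 1) ℚ./ r                   ≡⟨ ℚP.*-identityˡ _ ⟨
  1ℚ ℚ.* ((+ 1) ℚ./ r)          ≤⟨ ℚP.*-monoʳ-≤-nonNeg ((+ 1) ℚ./ r) {{ℚ.nonNegative (/-nonneg 1 r)}}
                                     (ℚP.≤-trans 1≤φ/ord φ/ord≤D) ⟩
  D q n r ℚ.* ((+ 1) ℚ./ r)     ∎
  where
  open ℚP.≤-Reasoning
  n = suc m
  r = suc r′
  k = repunit n r
  2≤r : 2 ≤ r
  2≤r = s≤s 1≤r′
  k⊥q : gcd k q ≡ 1
  k⊥q = subst (λ z → gcd k z ≡ 1) (sym q≡pᵉ) (gcd-prime-pow pp ¬p∣k e)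
  1≤q : 1 ≤ q
  1≤q = subst (1 ≤_) (sym q≡pᵉ) (ℕP.m^n>0 p {{prime⇒nonZero pp}} e)
  φ/ord≤D : φ/ord q k ℚ.≤ D q n r
  φ/ord≤D = D-≥-φ/ord q n r (s≤s 1≤m) (s≤s z≤n) k (repunit-positive m 1≤m r (s≤s z≤n))
    (repunit≤pow m 1≤m r) k⊥q (repunit-order m 1≤m r 2≤r)
  1≤φ/ord : 1ℚ ℚ.≤ φ/ord q k
  1≤φ/ord = /-mono 1 1 (φ k) (ord q k) (subst₂ _≤_ (sym (ℕP.*-identityˡ _)) (sym (ℕP.*-identityʳ _))
    (ord≤φ q (n * repunit n r′) 1≤q (trans (gcd-comm q k) k⊥q) (repunit-≥2 m 1≤m r 2≤r)))

C-nonneg : ∀ q n → 2 ≤ n → ∀ r → 1 ≤ r → 0ℚ ℚ.≤ C q n r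
C-nonneg q n 2≤n r 1≤r = *-nonneg _ _ (D-nonneg q n r 2≤n 1≤r) (/-nonneg 1 (suc (r ∸ 1)))

-- Then
-- C(1 + jP) ≥ 1/(1 + jP), so the partial sum up to 1 + 2^t P dominates
-- H_P(2^t) ≥ t/(2P + 1), which exceeds B once t = B⁺ (2P + 1) for a natural
-- number B⁺ ≥ B.
proposition4p14 : (p q n : ℕ) → Prime p → (∃[ e ] (1 ≤ e × q ≡ p ^ e)) → 2 ≤ n →
    ∀ (B : ℚ) → ∃[ N ] (∀ M → N ≤ M → B ≤ℚ partialC q n M)
proposition4p14 p q n@(suc m) pp (e , _ , q≡pᵉ) (s≤s 1≤m) B = N , λ M N≤M → begin
  B                                ≤⟨ ≤-numerator B ⟩
  (+ B⁺) ℚ./ 1                    ≤⟨ /-mono B⁺ 1 t c (ℕP.≤-reflexive (sym (ℕP.*-identityʳ t))) ⟩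
  (+ t) ℚ./ c                      ≤⟨ H-divergent P t ⟩
  H P (2 ^ t)                      ≤⟨ Σ-progression≤ (C q n) _ P 1≤P (C-nonneg q n (s≤s 1≤m)) C-on-progression (2 ^ t) ⟩
  Σ (C q n) N                      ≤⟨ Σ-mono-length (C q n) N M N≤M (C-nonneg q n (s≤s 1≤m)) ⟩
  Σ (C q n) M                      ≡⟨ sumℚ-oneTo (C q n) M ⟨
  partialC q n M                   ∎
  where
  open ℚP.≤-Reasoning
  period = repunit-period n pp
  P = proj₁ period
  1≤P = proj₁ (proj₂ period)
  C-on-progression : ∀ j → 1 ≤ j → (+ 1) ℚ./ suc (j * P) ℚ.≤ C q n (suc (j * P))
  C-on-progression j 1≤j = C-≥-reciprocal q m e pp q≡pᵉ 1≤m (j * P) (ℕP.*-mono-≤ 1≤j 1≤P) (proj₂ (proj₂ period) j)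
  B⁺ = ℤ.∣ ℚ.↥ B ∣
  c = suc (P + P)
  t = B⁺ * c
  N = suc (2 ^ t * P)
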